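{- Let $k\ge1$ and let $t_1,\dots,t_k$ be integers with $t_k\neq 0$. Let $\mathcal{C}(X)=X^k-t_1X^{k-1}-\dots-t_k$ and let $\mathbf{A}$ be its companion matrix (defined below), viewed in $GL_k(\mathbb{Q})$. Let $(F_n)_{n\in\mathbb{Z}}$ be the sequence of rationals defined by $F_n=F_{k,n}(t_1,\dots,t_k)$ for $n\ge0$ and extended to all $n\in\mathbb{Z}$ by $F_n=\sum_{j=1}^kt_jF_{n-j}$. Then $\mathbf{A}$ has finite multiplicative order if and only if $(F_n)_{n\in\mathbb{Z}}$ is periodic, and in that case the order of $\mathbf{A}$ equals the least period of $(F_n)$. Moreover, if $\mathcal{C}(X)$ is irreducible over $\mathbb{Q}$ and $(F_n)$ is periodic, then every complex root $\lambda$ of $\mathcal{C}(X)$ has finite multiplicative order, and this order equals the least period of $(F_n)$.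
   Context: The generalized Fibonacci polynomials are $F_{k,n}(t_1,\dots,t_k)=\sum_{\alpha}\binom{|\alpha|}{\alpha_1,\dots,\alpha_k}t_1^{\alpha_1}\cdots t_k^{\alpha_k}$ for $n\ge0$, the sum over all $\alpha=(\alpha_1,\dots,\alpha_k)\in\mathbb{Z}_{\ge0}^k$ with $\sum_j j\alpha_j=n$, where $|\alpha|=\sum_j\alpha_j$ (so $F_{k,0}=1$, $F_{k,1}=t_1$, $F_{k,2}=t_1^2+t_2$, ...); they satisfy $F_{k,n}=\sum_{j=1}^k t_jF_{k,n-j}$ for $n\ge1$ with the convention $F_{k,m}=0$ for $-k+1\le m\le -1$. The companion matrix $\mathbf{A}$ is the $k\times k$ matrix with $\mathbf{A}_{i,i+1}=1$ for $1\le i\le k-1$, last row $(t_k,t_{k-1},\dots,t_1)$, and all other entries $0$. A sequence $(f_n)$ is periodic if there is a positive integer $c$ with $f_{n+c}=f_n$ for all $n$; the least such $c$ is the least period. -}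

module Defs where

open import Level using (0ℓ)
open import Data.Nat as ℕ using (ℕ; zero; suc; _∸_; _≤_; _<_; _≤?_; _<?_)
open import Data.Nat.Combinatorics using (_C_)
open import Data.Integer as ℤ using (ℤ; +_; -[1+_])
open import Data.Rational as ℚ using (ℚ; 0ℚ; 1ℚ)
open import Data.Fin using (Fin; toℕ; fromℕ<)
open import Data.Vec using (Vec; []; _∷_)
open import Data.List using (List; []; _∷_; [_]; map; concatMap; upTo; foldr)
open import Data.Product using (Σ; ∃; _×_; _,_)
open import Relation.Binary.PropositionalEquality using (_≡_; _≢_)
open import Relation.Nullary using (¬_; yes; no)
open import Algebra.Bundles using (CommutativeRing)

-- Coefficients.  The parameters t₁,…,t_k are given as  t : Fin k → ℤ
-- with  t i = t_{toℕ i + 1}.  tℕ t j = t_j for 1 ≤ j ≤ k, and 0 otherwise.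

tℕ : {k : ℕ} → (Fin k → ℤ) → ℕ → ℤ
tℕ {k} t zero = + 0
tℕ {k} t (suc j) with j <? k
... | yes p = t (fromℕ< p)
... | no _  = + 0

lastIdx : {k : ℕ} → 1 ≤ k → Fin k
lastIdx {suc m} _ = Data.Fin.fromℕ m

toℚ : ℤ → ℚ
toℚ z = z ℚ./ 1

-- all α ∈ ℕ^m with  Σ_{j=1}^{m} (w + j) α_j = n
sols : (w m n : ℕ) → List (Vec ℕ m)
sols w zero zero    = [ [] ]
sols w zero (suc n) = []
sols w (suc m) n =
  concatMap (λ a → go a (suc w ℕ.* a ≤? n)) (upTo (suc n))
  where
  go : (a : ℕ) → Relation.Nullary.Dec (suc w ℕ.* a ≤ n) → List (Vec ℕ (suc m))
  go a (yes _) = map (a ∷_) (sols (suc w) m (n ∸ suc w ℕ.* a))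
  go a (no _)  = []

vsum : {m : ℕ} → Vec ℕ m → ℕ
vsum []       = 0
vsum (a ∷ as) = a ℕ.+ vsum as

-- multinomial coefficient ( |α| ; α₁,…,α_m ) = Π_j C(α_j + … + α_m, α_j)
multinom : {m : ℕ} → Vec ℕ m → ℕ
multinom []       = 1
multinom (a ∷ as) = ((a ℕ.+ vsum as) C a) ℕ.* multinom as

monom : {k : ℕ} → (Fin k → ℤ) → (w : ℕ) → {m : ℕ} → Vec ℕ m → ℤ
monom t w []       = + 1
monom t w (a ∷ as) = (tℕ t (suc w) ℤ.^ a) ℤ.* monom t (suc w) as

Fkn : (k : ℕ) → (Fin k → ℤ) → ℕ → ℤ
Fkn k t n = foldr ℤ._+_ (+ 0)
  (map (λ α → (+ multinom α) ℤ.* monom t 0 α) (sols 0 k n))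

∑Fin : {k : ℕ} → (Fin k → ℚ) → ℚ
∑Fin {zero}  f = 0ℚ
∑Fin {suc k} f = f Data.Fin.zero ℚ.+ ∑Fin (λ i → f (Data.Fin.suc i))

IsFibSeq : (k : ℕ) → (Fin k → ℤ) → (ℤ → ℚ) → Set
IsFibSeq k t F =
  (∀ (n : ℕ) → F (+ n) ≡ toℚ (Fkn k t n)) ×
  (∀ (n : ℤ) → F n ≡ ∑Fin (λ (i : Fin k) → toℚ (t i) ℚ.* F (n ℤ.- + suc (toℕ i))))

IsPeriod : (ℤ → ℚ) → ℕ → Set
IsPeriod F c = 1 ≤ c × (∀ (n : ℤ) → F (n ℤ.+ + c) ≡ F n)

Periodic : (ℤ → ℚ) → Set
Periodic F = ∃ λ c → IsPeriod F c

IsLeastPeriod : (ℤ → ℚ) → ℕ → Set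
IsLeastPeriod F c = IsPeriod F c × (∀ c' → IsPeriod F c' → c ≤ c')

Mat : ℕ → Set
Mat k = Fin k → Fin k → ℚ

_≈M_ : {k : ℕ} → Mat k → Mat k → Set
A ≈M B = ∀ i j → A i j ≡ B i j

_*M_ : {k : ℕ} → Mat k → Mat k → Mat k
(A *M B) i j = ∑Fin (λ l → A i l ℚ.* B l j)

Id : {k : ℕ} → Mat k
Id i j with toℕ i ℕ.≟ toℕ j
... | yes _ = 1ℚ
... | no _  = 0ℚ

_^M_ : {k : ℕ} → Mat k → ℕ → Mat k
A ^M zero  = Id
A ^M suc n = A *M (A ^M n)

-- companion matrix: A_{i,i+1} = 1 (1 ≤ i ≤ k-1), last row (t_k,…,t_1),
-- all other entries 0  (0-based indices below)
companion : (k : ℕ) → (Fin k → ℤ) → Mat k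
companion k t i j with suc (toℕ i) ℕ.≟ k
... | yes _ = toℚ (tℕ t (k ∸ toℕ j))
... | no _ with toℕ j ℕ.≟ suc (toℕ i)
...   | yes _ = 1ℚ
...   | no _  = 0ℚ

HasFiniteOrderM : {k : ℕ} → Mat k → Set
HasFiniteOrderM A = ∃ λ m → 1 ≤ m × (A ^M m) ≈M Id

IsOrderM : {k : ℕ} → Mat k → ℕ → Set
IsOrderM A m = (1 ≤ m × (A ^M m) ≈M Id) ×
               (∀ m' → 1 ≤ m' → (A ^M m') ≈M Id → m ≤ m')

-- The characteristic polynomial C(X) = X^k - t₁X^{k-1} - … - t_k,
-- as coefficient function (coefficient of X^n).

charCoeff : (k : ℕ) → (Fin k → ℤ) → ℕ → ℤ
charCoeff k t n with n ℕ.≟ k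
... | yes _ = + 1
... | no _ with n <? k
...   | yes _ = ℤ.- tℕ t (k ∸ n)
...   | no _  = + 0

-- polynomials over ℚ given by coefficient functions
IsPolyOfDegree : ℕ → (ℕ → ℚ) → Set
IsPolyOfDegree d c = c d ≢ 0ℚ × (∀ n → d < n → c n ≡ 0ℚ)

∑upto : ℕ → (ℕ → ℚ) → ℚ       -- Σ_{i=0}^{n} f i
∑upto zero    f = f 0
∑upto (suc n) f = ∑upto n f ℚ.+ f (suc n)

mulCoeff : (ℕ → ℚ) → (ℕ → ℚ) → ℕ → ℚ
mulCoeff p q n = ∑upto n (λ i → p i ℚ.* q (n ∸ i))

-- irreducible over ℚ: a polynomial of positive degree which is not a
-- product of two polynomials of positive degree (units of ℚ[X] are the
-- nonzero constants)
IrreducibleQ : (ℕ → ℚ) → Set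
IrreducibleQ c =
  (Σ ℕ λ d → IsPolyOfDegree d c × 1 ≤ d) ×
  ¬ (Σ ℕ λ dp → Σ ℕ λ dq → Σ (ℕ → ℚ) λ p → Σ (ℕ → ℚ) λ q →
       IsPolyOfDegree dp p × IsPolyOfDegree dq q × 1 ≤ dp × 1 ≤ dq ×
       (∀ n → mulCoeff p q n ≡ c n))

-- Stand-in for ℂ: an algebraically closed field of characteristic 0,
-- presented as a commutative ring with extra properties.

module _ (R : CommutativeRing 0ℓ 0ℓ) where
  open CommutativeRing R

  _^R_ : Carrier → ℕ → Carrier
  x ^R zero  = 1#
  x ^R suc n = x * (x ^R n)

  natR : ℕ → Carrier
  natR zero    = 0#
  natR (suc n) = 1# + natR n

  intR : ℤ → Carrier
  intR (+ n)     = natR n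
  intR -[1+ n ]  = - natR (suc n)

  ∑R : ℕ → (ℕ → Carrier) → Carrier       -- Σ_{i<n} f i
  ∑R zero    f = 0#
  ∑R (suc n) f = ∑R n f + f n

  IsField : Set
  IsField = (¬ (1# ≈ 0#)) × (∀ x → ¬ (x ≈ 0#) → ∃ λ y → (x * y) ≈ 1#)

  CharZero : Set
  CharZero = ∀ n → ¬ (natR (suc n) ≈ 0#)

  AlgClosed : Set
  AlgClosed = ∀ (n : ℕ) (c : ℕ → Carrier) →
    ∃ λ x → ((x ^R suc n) + ∑R (suc n) (λ i → c i * (x ^R i))) ≈ 0#

  IsRootOfC : (k : ℕ) → (Fin k → ℤ) → Carrier → Set
  IsRootOfC k t x = ∑R (suc k) (λ i → intR (charCoeff k t i) * (x ^R i)) ≈ 0#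

  HasFiniteOrderR : Carrier → Set
  HasFiniteOrderR x = ∃ λ m → 1 ≤ m × (x ^R m) ≈ 1#

  IsOrderR : Carrier → ℕ → Set
  IsOrderR x m = (1 ≤ m × (x ^R m) ≈ 1#) ×
                 (∀ m' → 1 ≤ m' → (x ^R m') ≈ 1# → m ≤ m')

{-# OPTIONS --safe #-}
-- The window vectors wₘ = (F m, …, F (m + k - 1)) satisfy A wₘ = wₘ₊₁, and w₋₍ₖ₋₁₎ is the last standard
-- basis vector: F vanishes at -1, …, -(k - 1) because tₖ ≠ 0, and F 0 = 1. Since the powers of A commute
-- with A, Aᶜ = I exactly when c is a period of F, so the order of A is the least period.
-- For a root λ of C, the vector (1, λ, …, λᵏ⁻¹) is an eigenvector of A for λ, so Aᶜ = I gives λᶜ = 1.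
-- Conversely, if λᶜ = 1 then the first row of Aᶜ - I is a rational polynomial of degree < k vanishing
-- at λ; as C is irreducible it is zero, and the first row of Aᶜ alone already makes c a period.
-- That the polynomials F_{k,n} satisfy the recurrence follows from Pascal's rule applied to the
-- multinomial coefficients, after sorting the terms by |α|.
module Submission where

open import Defs
open import Level using (Level; 0ℓ)
open import Algebra.Bundles using (CommutativeRing)
open import Algebra.Morphism.Structures using (module RingMorphisms)
import Algebra.Morphism.Construct.Identity as IdMorphism
open import Data.Nat as ℕ using (ℕ; zero; suc; _∸_; _≤_; _<_; _≤?_; _<?_; s≤s; z≤n)
import Data.Nat.Properties as ℕP
open import Data.Nat.Combinatorics using (_C_)
import Data.Nat.Combinatorics as ℕC
import Data.Nat.GCD as ℕG
open import Data.Integer as ℤ using (ℤ; +_; -[1+_])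
import Data.Integer.Properties as ℤP
import Data.Integer.Tactic.RingSolver as ℤSolver
open import Data.Rational as ℚ using (ℚ; 0ℚ; 1ℚ)
import Data.Rational.Properties as ℚP
open import Data.Rational.Solver using (module +-*-Solver)
import Data.Rational.Unnormalised as ℚᵘ
import Data.Rational.Unnormalised.Properties as ℚᵘP
open import Data.Fin as Fin using (Fin; toℕ; fromℕ<; opposite)
import Data.Fin.Properties as FinP
import Data.Fin.Permutation as Perm
open import Data.Vec using (Vec; []; _∷_)
open import Data.List using (List; []; _∷_; map; concatMap; upTo; applyUpTo; foldr; _++_)
open import Data.List.Properties using (concatMap-cong)
open import Data.Product using (Σ; ∃; _×_; _,_; proj₁; proj₂)
open import Data.Sum using (_⊎_; inj₁; inj₂)
open import Data.Empty using (⊥; ⊥-elim)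
open import Function using (_∘_)
open import Function.Bundles using (_⇔_; mk⇔; Equivalence)
open import Function.Construct.Composition using (_⇔-∘_)
open import Relation.Nullary using (¬_; Dec; yes; no)
open import Relation.Binary.PropositionalEquality as P using (_≡_; _≢_)

module FinSum {c ℓ : Level} (R : CommutativeRing c ℓ) where
  open CommutativeRing R
  open import Algebra.Properties.Semiring.Sum semiring public
  open import Algebra.Properties.AbelianGroup +-abelianGroup using (ε⁻¹≈ε; ⁻¹-∙-comm)

  sum-zero : ∀ {n} {f : Fin n → Carrier} → (∀ i → f i ≈ 0#) → sum f ≈ 0#
  sum-zero {zero}  _  = refl
  sum-zero {suc n} f0 = trans (+-cong (f0 Fin.zero) (sum-zero (f0 ∘ Fin.suc))) (+-identityˡ 0#)

  sum-single : ∀ {n} (f : Fin n → Carrier) (j : Fin n) → (∀ i → i ≢ j → f i ≈ 0#) → sum f ≈ f j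
  sum-single f Fin.zero f0 =
    trans (+-congˡ (sum-zero (λ i → f0 (Fin.suc i) (λ ())))) (+-identityʳ _)
  sum-single f (Fin.suc j) f0 =
    trans (+-cong (f0 Fin.zero (λ ()))
                  (sum-single (f ∘ Fin.suc) j (λ i i≢j → f0 (Fin.suc i) (i≢j ∘ FinP.suc-injective))))
          (+-identityˡ _)

  sum-reverse : ∀ {n} (f : Fin n → Carrier) → sum (f ∘ opposite) ≈ sum f
  sum-reverse f = sym (∑-permute f Perm.reverse)

  -‿sum : ∀ {n} (f : Fin n → Carrier) → - sum f ≈ sum (λ i → - f i)
  -‿sum {zero}  f = ε⁻¹≈ε
  -‿sum {suc n} f = trans (sym (⁻¹-∙-comm _ _)) (+-congˡ (-‿sum (f ∘ Fin.suc)))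

module ℚSum = FinSum ℚP.+-*-commutativeRing
module ℤSum = FinSum ℤP.+-*-commutativeRing

∑Fin≡sum : ∀ {k} (f : Fin k → ℚ) → ∑Fin f ≡ ℚSum.sum f
∑Fin≡sum {zero}  f = P.refl
∑Fin≡sum {suc k} f = P.cong (f Fin.zero ℚ.+_) (∑Fin≡sum (f ∘ Fin.suc))

↥-toℚ : ∀ z → ℚ.↥ (toℚ z) ≡ z
↥-toℚ z = P.trans (P.sym (ℤP.*-identityʳ _))
  (P.trans (P.cong (ℚ.↥ (toℚ z) ℤ.*_) (P.cong +_ (P.sym (ℕG.gcd-zeroʳ ℤ.∣ z ∣)))) (ℚP.↥-/ z 1))

↧-toℚ : ∀ z → ℚ.↧ (toℚ z) ≡ + 1
↧-toℚ z = P.trans (P.sym (ℤP.*-identityʳ _))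
  (P.trans (P.cong (ℚ.↧ (toℚ z) ℤ.*_) (P.cong +_ (P.sym (ℕG.gcd-zeroʳ ℤ.∣ z ∣)))) (ℚP.↧-/ z 1))

toℚᵘ-toℚ : ∀ z → ℚ.toℚᵘ (toℚ z) ℚᵘ.≃ ℚᵘ.mkℚᵘ z 0
toℚᵘ-toℚ z = ℚᵘ.*≡* (P.cong₂ ℤ._*_ (P.trans (ℚP.↥ᵘ-toℚᵘ (toℚ z)) (↥-toℚ z))
                                    (P.sym (P.trans (ℚP.↧ᵘ-toℚᵘ (toℚ z)) (↧-toℚ z))))

toℚ-injective : ∀ {a b} → toℚ a ≡ toℚ b → a ≡ b
toℚ-injective {a} {b} e = P.trans (P.sym (↥-toℚ a)) (P.trans (P.cong ℚ.↥_ e) (↥-toℚ b))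

-- Both sides are compared as unnormalised fractions with denominator 1.
toℚ-+ : ∀ a b → toℚ (a ℤ.+ b) ≡ toℚ a ℚ.+ toℚ b
toℚ-+ a b = ℚP.toℚᵘ-injective (ℚᵘP.≃-trans (toℚᵘ-toℚ (a ℤ.+ b)) (ℚᵘP.≃-trans
  (ℚᵘ.*≡* (unit-denominators a b))
  (ℚᵘP.≃-sym (ℚᵘP.≃-trans (ℚP.toℚᵘ-homo-+ (toℚ a) (toℚ b)) (ℚᵘP.+-cong (toℚᵘ-toℚ a) (toℚᵘ-toℚ b))))))
  where
  unit-denominators : ∀ a b → (a ℤ.+ b) ℤ.* + 1 ≡ (a ℤ.* + 1 ℤ.+ b ℤ.* + 1) ℤ.* + 1
  unit-denominators = ℤSolver.solve-∀

toℚ-* : ∀ a b → toℚ (a ℤ.* b) ≡ toℚ a ℚ.* toℚ b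
toℚ-* a b = ℚP.toℚᵘ-injective (ℚᵘP.≃-trans (toℚᵘ-toℚ (a ℤ.* b))
  (ℚᵘP.≃-sym (ℚᵘP.≃-trans (ℚP.toℚᵘ-homo-* (toℚ a) (toℚ b)) (ℚᵘP.*-cong (toℚᵘ-toℚ a) (toℚᵘ-toℚ b)))))

toℚ-sum : ∀ {n} (f : Fin n → ℤ) → toℚ (ℤSum.sum f) ≡ ℚSum.sum (toℚ ∘ f)
toℚ-sum {zero}  f = P.refl
toℚ-sum {suc n} f = P.trans (toℚ-+ (f Fin.zero) _) (P.cong (toℚ (f Fin.zero) ℚ.+_) (toℚ-sum (f ∘ Fin.suc)))

module IntegersIn (R : CommutativeRing 0ℓ 0ℓ) where
  open CommutativeRing R
  open import Relation.Binary.Reasoning.Setoid setoid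
  open import Algebra.Properties.Ring ring using (-‿distribˡ-*; -‿distribʳ-*; -‿involutive; -‿+-comm; -0#≈0#)
  open import Algebra.Properties.CommutativeSemigroup +-commutativeSemigroup using (interchange)

  private
    sub+sub : ∀ a b c d → (a - b) + (c - d) ≈ (a + c) - (b + d)
    sub+sub a b c d = trans (interchange a (- b) c (- d)) (+-congˡ (-‿+-comm b d))

    sub*sub : ∀ a b c d → (a - b) * (c - d) ≈ (a * c + b * d) - (a * d + b * c)
    sub*sub a b c d = begin
      (a - b) * (c - d)                         ≈⟨ distribʳ (c - d) a (- b) ⟩
      a * (c - d) + - b * (c - d)               ≈⟨ +-cong (distribˡ a c (- d)) (distribˡ (- b) c (- d)) ⟩
      (a * c + a * - d) + (- b * c + - b * - d) ≈⟨ +-cong (+-congˡ (sym (-‿distribʳ-* a d)))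
                                                          (+-cong (sym (-‿distribˡ-* b c)) -b*-d≈bd) ⟩
      (a * c + - (a * d)) + (- (b * c) + b * d) ≈⟨ +-congˡ (+-comm _ _) ⟩
      (a * c + - (a * d)) + (b * d + - (b * c)) ≈⟨ interchange _ _ _ _ ⟩
      (a * c + b * d) + (- (a * d) + - (b * c)) ≈⟨ +-congˡ (-‿+-comm _ _) ⟩
      (a * c + b * d) - (a * d + b * c)         ∎
      where
      -b*-d≈bd : - b * - d ≈ b * d
      -b*-d≈bd = trans (sym (-‿distribˡ-* b (- d))) (trans (-‿cong (sym (-‿distribʳ-* b d))) (-‿involutive _))

  natR-+ : ∀ m n → natR R (m ℕ.+ n) ≈ natR R m + natR R n
  natR-+ zero    n = sym (+-identityˡ _)
  natR-+ (suc m) n = trans (+-congˡ (natR-+ m n)) (sym (+-assoc _ _ _))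

  natR-* : ∀ m n → natR R (m ℕ.* n) ≈ natR R m * natR R n
  natR-* zero    n = sym (zeroˡ _)
  natR-* (suc m) n =
    trans (natR-+ n (m ℕ.* n)) (trans (+-cong (sym (*-identityˡ _)) (natR-* m n)) (sym (distribʳ _ _ _)))

  intR-⊖ : ∀ m n → intR R (m ℤ.⊖ n) ≈ natR R m - natR R n
  intR-⊖ m       zero    = trans (reflexive (P.cong (intR R) (ℤP.⊖-≥ {m} {0} z≤n)))
                                 (trans (sym (+-identityʳ _)) (+-congˡ (sym -0#≈0#)))
  intR-⊖ zero    (suc n) = trans (reflexive (P.cong (intR R) (ℤP.⊖-< {0} {suc n} (s≤s z≤n)))) (sym (+-identityˡ _))
  intR-⊖ (suc m) (suc n) = begin
    intR R (suc m ℤ.⊖ suc n)          ≈⟨ reflexive (P.cong (intR R) (ℤP.[1+m]⊖[1+n]≡m⊖n m n)) ⟩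
    intR R (m ℤ.⊖ n)                  ≈⟨ intR-⊖ m n ⟩
    natR R m - natR R n               ≈⟨ sym (+-identityˡ _) ⟩
    0# + (natR R m - natR R n)        ≈⟨ +-congʳ (sym (-‿inverseʳ 1#)) ⟩
    (1# - 1#) + (natR R m - natR R n) ≈⟨ sub+sub 1# 1# _ _ ⟩
    natR R (suc m) - natR R (suc n)   ∎

  private
    positivePart negativePart : ℤ → ℕ
    positivePart (+ n)    = n
    positivePart -[1+ n ] = 0
    negativePart (+ n)    = 0
    negativePart -[1+ n ] = suc n

    split : ∀ z → z ≡ + positivePart z ℤ.- + negativePart z
    split (+ n)    = P.sym (ℤP.+-identityʳ (+ n))
    split -[1+ n ] = P.refl

    intR-split : ∀ z → intR R z ≈ natR R (positivePart z) - natR R (negativePart z)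
    intR-split z = trans (reflexive (P.cong (intR R) (P.trans (split z) (ℤP.m-n≡m⊖n (positivePart z) (negativePart z)))))
                         (intR-⊖ (positivePart z) (negativePart z))

    intR-difference : ∀ m n → intR R (+ m ℤ.- + n) ≈ natR R m - natR R n
    intR-difference m n = trans (reflexive (P.cong (intR R) (ℤP.m-n≡m⊖n m n))) (intR-⊖ m n)

  intR-+ : ∀ a b → intR R (a ℤ.+ b) ≈ intR R a + intR R b
  intR-+ a b = begin
    intR R (a ℤ.+ b)                                       ≈⟨ reflexive (P.cong (intR R) (P.trans
                                                               (P.cong₂ ℤ._+_ (split a) (split b))
                                                                   (rearrange (+ pa) (+ na) (+ pb) (+ nb)))) ⟩
    intR R (+ (pa ℕ.+ pb) ℤ.- + (na ℕ.+ nb))               ≈⟨ intR-difference (pa ℕ.+ pb) (na ℕ.+ nb) ⟩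
    natR R (pa ℕ.+ pb) - natR R (na ℕ.+ nb)                ≈⟨ +-cong (natR-+ pa pb) (-‿cong (natR-+ na nb)) ⟩
    (natR R pa + natR R pb) - (natR R na + natR R nb)      ≈⟨ sym (sub+sub (natR R pa) (natR R na) (natR R pb) (natR R nb)) ⟩
    (natR R pa - natR R na) + (natR R pb - natR R nb)      ≈⟨ sym (+-cong (intR-split a) (intR-split b)) ⟩
    intR R a + intR R b                                    ∎
    where
    pa pb na nb : ℕ
    pa = positivePart a ; pb = positivePart b ; na = negativePart a ; nb = negativePart b
    rearrange : ∀ (x y u v : ℤ) → (x ℤ.- y) ℤ.+ (u ℤ.- v) ≡ (x ℤ.+ u) ℤ.- (y ℤ.+ v)
    rearrange = ℤSolver.solve-∀

  intR-* : ∀ a b → intR R (a ℤ.* b) ≈ intR R a * intR R b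
  intR-* a b = begin
    intR R (a ℤ.* b)                                          ≈⟨ reflexive (P.cong (intR R) (P.trans
                                                                  (P.cong₂ ℤ._*_ (split a) (split b)) (expand pa na pb nb))) ⟩
    intR R (+ (pa ℕ.* pb ℕ.+ na ℕ.* nb) ℤ.- + (pa ℕ.* nb ℕ.+ na ℕ.* pb))
                                                              ≈⟨ intR-difference (pa ℕ.* pb ℕ.+ na ℕ.* nb) (pa ℕ.* nb ℕ.+ na ℕ.* pb) ⟩
    natR R (pa ℕ.* pb ℕ.+ na ℕ.* nb) - natR R (pa ℕ.* nb ℕ.+ na ℕ.* pb)
      ≈⟨ +-cong (trans (natR-+ (pa ℕ.* pb) (na ℕ.* nb)) (+-cong (natR-* pa pb) (natR-* na nb)))
                (-‿cong (trans (natR-+ (pa ℕ.* nb) (na ℕ.* pb)) (+-cong (natR-* pa nb) (natR-* na pb)))) ⟩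
    (natR R pa * natR R pb + natR R na * natR R nb) - (natR R pa * natR R nb + natR R na * natR R pb)
                                                              ≈⟨ sym (sub*sub (natR R pa) (natR R na) (natR R pb) (natR R nb)) ⟩
    (natR R pa - natR R na) * (natR R pb - natR R nb)         ≈⟨ sym (*-cong (intR-split a) (intR-split b)) ⟩
    intR R a * intR R b                                       ∎
    where
    pa pb na nb : ℕ
    pa = positivePart a ; pb = positivePart b ; na = negativePart a ; nb = negativePart b
    ring-identity : ∀ (x y u v : ℤ) → (x ℤ.- y) ℤ.* (u ℤ.- v) ≡ (x ℤ.* u ℤ.+ y ℤ.* v) ℤ.- (x ℤ.* v ℤ.+ y ℤ.* u)
    ring-identity = ℤSolver.solve-∀
    expand : ∀ pa na pb nb → (+ pa ℤ.- + na) ℤ.* (+ pb ℤ.- + nb) ≡ + (pa ℕ.* pb ℕ.+ na ℕ.* nb) ℤ.- + (pa ℕ.* nb ℕ.+ na ℕ.* pb)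
    expand pa na pb nb = P.trans (ring-identity (+ pa) (+ na) (+ pb) (+ nb))
      (P.cong₂ ℤ._-_ (P.cong₂ ℤ._+_ (P.sym (ℤP.pos-* pa pb)) (P.sym (ℤP.pos-* na nb)))
                     (P.cong₂ ℤ._+_ (P.sym (ℤP.pos-* pa nb)) (P.sym (ℤP.pos-* na pb))))

  intR-neg : ∀ a → intR R (ℤ.- a) ≈ - intR R a
  intR-neg (+ zero)  = sym -0#≈0#
  intR-neg (+ suc n) = refl
  intR-neg -[1+ n ]  = sym (-‿involutive _)

module RationalsIn (R : CommutativeRing 0ℓ 0ℓ) (field-R : IsField R) (charZero : CharZero R) where
  open CommutativeRing R
  open import Relation.Binary.Reasoning.Setoid setoid
  open import Algebra.Properties.Ring ring using (-0#≈0#; -‿involutive)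
  open import Algebra.Properties.Group +-group using (inverseʳ-unique)
  open import Algebra.Properties.CommutativeSemigroup *-commutativeSemigroup using (interchange)
  open IntegersIn R
  open RingMorphisms ℚ.+-*-rawRing rawRing

  -- The denominators of ℚᵘ are  suc d, and  inverse d  is the inverse of  suc d  in R.
  private
    denominator : ℕ → Carrier
    denominator d = natR R (suc d)

    inverse : ℕ → Carrier
    inverse d = proj₁ (proj₂ field-R (denominator d) (charZero d))

    denominator*inverse : ∀ d → denominator d * inverse d ≈ 1#
    denominator*inverse d = proj₂ (proj₂ field-R (denominator d) (charZero d))

    inverse-unique : ∀ x y y' → x * y ≈ 1# → x * y' ≈ 1# → y ≈ y'
    inverse-unique x y y' xy≈1 xy'≈1 = begin
      y            ≈⟨ sym (*-identityʳ y) ⟩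
      y * 1#       ≈⟨ *-congˡ (sym xy'≈1) ⟩
      y * (x * y') ≈⟨ sym (*-assoc y x y') ⟩
      (y * x) * y' ≈⟨ *-congʳ (trans (*-comm y x) xy≈1) ⟩
      1# * y'      ≈⟨ *-identityˡ y' ⟩
      y'           ∎

    inverse-* : ∀ d₁ d₂ d → denominator d ≈ denominator d₁ * denominator d₂ → inverse d ≈ inverse d₁ * inverse d₂
    inverse-* d₁ d₂ d e = inverse-unique (denominator d) _ _ (denominator*inverse d) (begin
      denominator d * (inverse d₁ * inverse d₂)                   ≈⟨ *-congʳ e ⟩
      (denominator d₁ * denominator d₂) * (inverse d₁ * inverse d₂) ≈⟨ interchange _ _ _ _ ⟩
      (denominator d₁ * inverse d₁) * (denominator d₂ * inverse d₂) ≈⟨ *-cong (denominator*inverse d₁) (denominator*inverse d₂) ⟩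
      1# * 1#                                                     ≈⟨ *-identityˡ 1# ⟩
      1#                                                          ∎)

    inverse-0 : inverse 0 ≈ 1#
    inverse-0 = inverse-unique (denominator 0) (inverse 0) 1# (denominator*inverse 0)
                               (trans (*-identityʳ (denominator 0)) (+-identityʳ 1#))

    embedᵘ : ℚᵘ.ℚᵘ → Carrier
    embedᵘ (ℚᵘ.mkℚᵘ n d) = intR R n * inverse d

    expand : ∀ n d d' → intR R n * inverse d ≈ (intR R n * denominator d') * (inverse d * inverse d')
    expand n d d' = begin
      intR R n * inverse d                                          ≈⟨ sym (*-identityʳ _) ⟩
      (intR R n * inverse d) * 1#                                   ≈⟨ *-congˡ (sym (denominator*inverse d')) ⟩
      (intR R n * inverse d) * (denominator d' * inverse d')        ≈⟨ interchange _ _ _ _ ⟩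
      (intR R n * denominator d') * (inverse d * inverse d')        ∎

    embedᵘ-cong : ∀ {p q} → p ℚᵘ.≃ q → embedᵘ p ≈ embedᵘ q
    embedᵘ-cong {ℚᵘ.mkℚᵘ n₁ d₁} {ℚᵘ.mkℚᵘ n₂ d₂} (ℚᵘ.*≡* e) = begin
      intR R n₁ * inverse d₁                               ≈⟨ expand n₁ d₁ d₂ ⟩
      (intR R n₁ * denominator d₂) * (inverse d₁ * inverse d₂) ≈⟨ *-congʳ (sym (intR-* n₁ (+ suc d₂))) ⟩
      intR R (n₁ ℤ.* + suc d₂) * (inverse d₁ * inverse d₂) ≈⟨ *-congʳ (reflexive (P.cong (intR R) e)) ⟩
      intR R (n₂ ℤ.* + suc d₁) * (inverse d₁ * inverse d₂) ≈⟨ *-cong (intR-* n₂ (+ suc d₁)) (*-comm _ _) ⟩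
      (intR R n₂ * denominator d₁) * (inverse d₂ * inverse d₁) ≈⟨ sym (expand n₂ d₂ d₁) ⟩
      intR R n₂ * inverse d₂                               ∎

    embedᵘ-+ : ∀ p q → embedᵘ (p ℚᵘ.+ q) ≈ embedᵘ p + embedᵘ q
    embedᵘ-+ (ℚᵘ.mkℚᵘ n₁ d₁) (ℚᵘ.mkℚᵘ n₂ d₂) = begin
      intR R (n₁ ℤ.* + suc d₂ ℤ.+ n₂ ℤ.* + suc d₁) * inverse (d₂ ℕ.+ d₁ ℕ.* suc d₂)
        ≈⟨ *-cong (intR-+ (n₁ ℤ.* + suc d₂) (n₂ ℤ.* + suc d₁)) (inverse-* d₁ d₂ (d₂ ℕ.+ d₁ ℕ.* suc d₂) (natR-* (suc d₁) (suc d₂))) ⟩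
      (intR R (n₁ ℤ.* + suc d₂) + intR R (n₂ ℤ.* + suc d₁)) * (inverse d₁ * inverse d₂)
        ≈⟨ *-congʳ (+-cong (intR-* n₁ (+ suc d₂)) (intR-* n₂ (+ suc d₁))) ⟩
      ((intR R n₁ * denominator d₂) + (intR R n₂ * denominator d₁)) * (inverse d₁ * inverse d₂)
        ≈⟨ distribʳ _ _ _ ⟩
      (intR R n₁ * denominator d₂) * (inverse d₁ * inverse d₂) + (intR R n₂ * denominator d₁) * (inverse d₁ * inverse d₂)
        ≈⟨ +-cong (sym (expand n₁ d₁ d₂)) (trans (*-congˡ (*-comm _ _)) (sym (expand n₂ d₂ d₁))) ⟩
      intR R n₁ * inverse d₁ + intR R n₂ * inverse d₂ ∎

    embedᵘ-* : ∀ p q → embedᵘ (p ℚᵘ.* q) ≈ embedᵘ p * embedᵘ q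
    embedᵘ-* (ℚᵘ.mkℚᵘ n₁ d₁) (ℚᵘ.mkℚᵘ n₂ d₂) =
      trans (*-cong (intR-* n₁ n₂) (inverse-* d₁ d₂ (d₂ ℕ.+ d₁ ℕ.* suc d₂) (natR-* (suc d₁) (suc d₂)))) (interchange _ _ _ _)

  embed : ℚ → Carrier
  embed q = embedᵘ (ℚ.toℚᵘ q)

  embed-+ : ∀ a b → embed (a ℚ.+ b) ≈ embed a + embed b
  embed-+ a b = trans (embedᵘ-cong (ℚP.toℚᵘ-homo-+ a b)) (embedᵘ-+ (ℚ.toℚᵘ a) (ℚ.toℚᵘ b))

  embed-* : ∀ a b → embed (a ℚ.* b) ≈ embed a * embed b
  embed-* a b = trans (embedᵘ-cong (ℚP.toℚᵘ-homo-* a b)) (embedᵘ-* (ℚ.toℚᵘ a) (ℚ.toℚᵘ b))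

  embed-0 : embed 0ℚ ≈ 0#
  embed-0 = zeroˡ _

  embed-1 : embed 1ℚ ≈ 1#
  embed-1 = denominator*inverse 0

  embed-neg : ∀ a → embed (ℚ.- a) ≈ - embed a
  embed-neg a = inverseʳ-unique (embed a) (embed (ℚ.- a))
    (trans (sym (embed-+ a (ℚ.- a))) (trans (reflexive (P.cong embed (ℚP.+-inverseʳ a))) embed-0))

  embed-isRingHomomorphism : IsRingHomomorphism embed
  embed-isRingHomomorphism = record
    { isSemiringHomomorphism = record
      { isNearSemiringHomomorphism = record
        { +-isMonoidHomomorphism = record
          { isMagmaHomomorphism = record
            { isRelHomomorphism = record { cong = λ { P.refl → refl } }
            ; homo = embed-+ }
          ; ε-homo = embed-0 }
        ; *-homo = embed-* }
      ; 1#-homo = embed-1 }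
    ; -‿homo = embed-neg }

  embed-toℚ : ∀ z → embed (toℚ z) ≈ intR R z
  embed-toℚ z = trans (embedᵘ-cong (toℚᵘ-toℚ z)) (trans (*-congˡ inverse-0) (*-identityʳ _))

  intR≈0⇒≡0 : ∀ z → intR R z ≈ 0# → z ≡ + 0
  intR≈0⇒≡0 (+ zero)    _ = P.refl
  intR≈0⇒≡0 (+ suc n)   e = ⊥-elim (charZero n e)
  intR≈0⇒≡0 -[1+ n ]    e = ⊥-elim (charZero n (trans (sym (-‿involutive _)) (trans (-‿cong e) -0#≈0#)))

  embed≈0⇒≡0 : ∀ a → embed a ≈ 0# → a ≡ 0ℚ
  embed≈0⇒≡0 a@(ℚ.mkℚ n d _) e = ℚP.↥p≡0⇒p≡0 a (intR≈0⇒≡0 n (begin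
    intR R n                                     ≈⟨ sym (*-identityʳ _) ⟩
    intR R n * 1#                                ≈⟨ *-congˡ (sym (trans (*-comm _ _) (denominator*inverse d))) ⟩
    intR R n * (inverse d * denominator d)       ≈⟨ sym (*-assoc _ _ _) ⟩
    (intR R n * inverse d) * denominator d       ≈⟨ *-congʳ e ⟩
    0# * denominator d                           ≈⟨ zeroˡ _ ⟩
    0#                                           ∎))

Id-diagonal : ∀ {k} (i : Fin k) → Id i i ≡ 1ℚ
Id-diagonal i with toℕ i ℕ.≟ toℕ i
... | yes _   = P.refl
... | no i≢i = ⊥-elim (i≢i P.refl)

Id-offDiagonal : ∀ {k} {i j : Fin k} → i ≢ j → Id i j ≡ 0ℚ
Id-offDiagonal {i = i} {j} i≢j with toℕ i ℕ.≟ toℕ j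
... | yes e = ⊥-elim (i≢j (FinP.toℕ-injective e))
... | no _  = P.refl

module MatrixAction {c ℓ : Level} (R : CommutativeRing c ℓ) (φ : ℚ → CommutativeRing.Carrier R)
  (φ-hom : RingMorphisms.IsRingHomomorphism ℚ.+-*-rawRing (CommutativeRing.rawRing R) φ) where
  open CommutativeRing R
  open FinSum R
  open RingMorphisms.IsRingHomomorphism φ-hom using (+-homo; *-homo; 0#-homo; 1#-homo)
  open import Relation.Binary.Reasoning.Setoid setoid

  infixr 7 _⊙_
  _⊙_ : ∀ {k} → Mat k → (Fin k → Carrier) → Fin k → Carrier
  (M ⊙ v) i = sum (λ l → φ (M i l) * v l)

  φ-∑Fin : ∀ {k} (f : Fin k → ℚ) → φ (∑Fin f) ≈ sum (φ ∘ f)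
  φ-∑Fin {zero}  f = 0#-homo
  φ-∑Fin {suc k} f = trans (+-homo (f Fin.zero) _) (+-congˡ (φ-∑Fin (f ∘ Fin.suc)))

  ⊙-rowCong : ∀ {k} {X Y : Mat k} {u v : Fin k → Carrier} {i} → (∀ l → X i l ≡ Y i l) → (∀ l → u l ≈ v l) →
              (X ⊙ u) i ≈ (Y ⊙ v) i
  ⊙-rowCong {k} Xᵢ≡Yᵢ u≈v = sum-cong-≋ {k} (λ l → *-cong (reflexive (P.cong φ (Xᵢ≡Yᵢ l))) (u≈v l))

  ⊙-cong : ∀ {k} {X Y : Mat k} {u v : Fin k → Carrier} → X ≈M Y → (∀ l → u l ≈ v l) →
           ∀ i → (X ⊙ u) i ≈ (Y ⊙ v) i
  ⊙-cong {X = X} {Y} X≈Y u≈v i = ⊙-rowCong {X = X} {Y} {i = i} (X≈Y i) u≈v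

  ⊙-congʳ : ∀ {k} (X : Mat k) {u v : Fin k → Carrier} → (∀ l → u l ≈ v l) → ∀ i → (X ⊙ u) i ≈ (X ⊙ v) i
  ⊙-congʳ X = ⊙-cong {X = X} (λ _ _ → P.refl)

  *M-⊙ : ∀ {k} (X Y : Mat k) v i → ((X *M Y) ⊙ v) i ≈ (X ⊙ (Y ⊙ v)) i
  *M-⊙ {k} X Y v i = begin
    sum (λ l → φ (∑Fin (λ m → X i m ℚ.* Y m l)) * v l)
      ≈⟨ sum-cong-≋ {k} (λ l → *-congʳ (φ-∑Fin (λ m → X i m ℚ.* Y m l))) ⟩
    sum (λ l → sum (λ m → φ (X i m ℚ.* Y m l)) * v l)
      ≈⟨ sum-cong-≋ {k} (λ l → *-distribʳ-sum (v l) (λ m → φ (X i m ℚ.* Y m l))) ⟩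
    sum (λ l → sum (λ m → φ (X i m ℚ.* Y m l) * v l))
      ≈⟨ ∑-comm (λ l m → φ (X i m ℚ.* Y m l) * v l) ⟩
    sum (λ m → sum (λ l → φ (X i m ℚ.* Y m l) * v l))
      ≈⟨ sum-cong-≋ {k} (λ m → sum-cong-≋ {k} (λ l → trans (*-congʳ (*-homo (X i m) (Y m l))) (*-assoc _ _ _))) ⟩
    sum (λ m → sum (λ l → φ (X i m) * (φ (Y m l) * v l)))
      ≈⟨ sum-cong-≋ {k} (λ m → sym (*-distribˡ-sum (φ (X i m)) (λ l → φ (Y m l) * v l))) ⟩
    sum (λ m → φ (X i m) * (Y ⊙ v) m) ∎

  ⊙-+ : ∀ {k} (X : Mat k) u v i → (X ⊙ (λ l → u l + v l)) i ≈ (X ⊙ u) i + (X ⊙ v) i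
  ⊙-+ {k} X u v i = trans (sum-cong-≋ {k} (λ l → distribˡ (φ (X i l)) (u l) (v l)))
      (∑-distrib-+ (λ l → φ (X i l) * u l) (λ l → φ (X i l) * v l))

  ⊙-* : ∀ {k} (X : Mat k) a v i → (X ⊙ (λ l → a * v l)) i ≈ a * (X ⊙ v) i
  ⊙-* {k} X a v i = trans (sum-cong-≋ {k} (λ l → x*[y*z]≈y*[x*z] (φ (X i l)) a (v l))) (sym (*-distribˡ-sum a (λ l → φ (X i l) * v l)))
    where
    x*[y*z]≈y*[x*z] : ∀ x y z → x * (y * z) ≈ y * (x * z)
    x*[y*z]≈y*[x*z] x y z = trans (sym (*-assoc x y z)) (trans (*-congʳ (*-comm x y)) (*-assoc y x z))

  Id-⊙ : ∀ {k} v (i : Fin k) → (Id ⊙ v) i ≈ v i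
  Id-⊙ v i = begin
    sum (λ l → φ (Id i l) * v l) ≈⟨ sum-single _ i (λ l l≢i → trans (*-congʳ (trans
                                      (reflexive (P.cong φ (Id-offDiagonal (l≢i ∘ P.sym)))) 0#-homo)) (zeroˡ _)) ⟩
    φ (Id i i) * v i             ≈⟨ *-congʳ (trans (reflexive (P.cong φ (Id-diagonal i))) 1#-homo) ⟩
    1# * v i                     ≈⟨ *-identityˡ _ ⟩
    v i                          ∎

  ^M-⊙-comm : ∀ {k} (X : Mat k) n v i → ((X ^M n) ⊙ (X ⊙ v)) i ≈ (X ⊙ ((X ^M n) ⊙ v)) i
  ^M-⊙-comm X zero    v i = trans (Id-⊙ (X ⊙ v) i) (⊙-congʳ X (λ l → sym (Id-⊙ v l)) i)
  ^M-⊙-comm X (suc n) v i = begin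
    ((X *M (X ^M n)) ⊙ (X ⊙ v)) i ≈⟨ *M-⊙ X (X ^M n) (X ⊙ v) i ⟩
    (X ⊙ ((X ^M n) ⊙ (X ⊙ v))) i  ≈⟨ ⊙-congʳ X (^M-⊙-comm X n v) i ⟩
    (X ⊙ (X ⊙ ((X ^M n) ⊙ v))) i  ≈⟨ ⊙-congʳ X (λ l → sym (*M-⊙ X (X ^M n) v l)) i ⟩
    (X ⊙ ((X *M (X ^M n)) ⊙ v)) i ∎

module ℚAction = MatrixAction ℚP.+-*-commutativeRing (λ q → q) (IdMorphism.isRingHomomorphism ℚ.+-*-rawRing P.refl)

module _ {k : ℕ} (t : Fin k → ℤ) where

  companion-lastRow : ∀ {i j : Fin k} → suc (toℕ i) ≡ k → companion k t i j ≡ toℚ (tℕ t (k ∸ toℕ j))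
  companion-lastRow {i} e with suc (toℕ i) ℕ.≟ k
  ... | yes _   = P.refl
  ... | no i+1≢k = ⊥-elim (i+1≢k e)

  companion-superdiagonal : ∀ {i j : Fin k} → toℕ j ≡ suc (toℕ i) → companion k t i j ≡ 1ℚ
  companion-superdiagonal {i} {j} e with suc (toℕ i) ℕ.≟ k
  ... | yes i+1≡k = ⊥-elim (ℕP.<-irrefl (P.trans e i+1≡k) (FinP.toℕ<n j))
  ... | no _ with toℕ j ℕ.≟ suc (toℕ i)
  ...   | yes _     = P.refl
  ...   | no j≢i+1 = ⊥-elim (j≢i+1 e)

  companion-elsewhere : ∀ {i j : Fin k} → suc (toℕ i) ≢ k → toℕ j ≢ suc (toℕ i) → companion k t i j ≡ 0ℚ
  companion-elsewhere {i} {j} i+1≢k j≢i+1 with suc (toℕ i) ℕ.≟ k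
  ... | yes i+1≡k = ⊥-elim (i+1≢k i+1≡k)
  ... | no _ with toℕ j ℕ.≟ suc (toℕ i)
  ...   | yes j≡i+1 = ⊥-elim (j≢i+1 j≡i+1)
  ...   | no _      = P.refl

module CompanionAction {c ℓ : Level} (R : CommutativeRing c ℓ) (φ : ℚ → CommutativeRing.Carrier R)
  (φ-hom : RingMorphisms.IsRingHomomorphism ℚ.+-*-rawRing (CommutativeRing.rawRing R) φ)
  {k : ℕ} (t : Fin k → ℤ) where
  open CommutativeRing R
  open FinSum R
  open MatrixAction R φ φ-hom
  open RingMorphisms.IsRingHomomorphism φ-hom using (0#-homo; 1#-homo)

  companion-⊙-shift : ∀ v {i : Fin k} (i+1<k : suc (toℕ i) < k) → (companion k t ⊙ v) i ≈ v (fromℕ< i+1<k)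
  companion-⊙-shift v {i} i+1<k =
    trans (sum-single _ j (λ l l≢j → trans (*-congʳ (trans (reflexive (P.cong φ
                 (companion-elsewhere t (ℕP.<⇒≢ i+1<k) (λ e → l≢j (FinP.toℕ-injective (P.trans e (P.sym toℕj))))))) 0#-homo))
               (zeroˡ _)))
          (trans (*-congʳ (trans (reflexive (P.cong φ (companion-superdiagonal t toℕj))) 1#-homo)) (*-identityˡ _))
    where
    j : Fin k
    j = fromℕ< i+1<k
    toℕj : toℕ j ≡ suc (toℕ i)
    toℕj = FinP.toℕ-fromℕ< i+1<k

  companion-⊙-last : ∀ v {i : Fin k} → suc (toℕ i) ≡ k →
                     (companion k t ⊙ v) i ≈ sum (λ l → φ (toℚ (tℕ t (k ∸ toℕ l))) * v l)
  companion-⊙-last v i+1≡k = sum-cong-≋ {k} (λ l → *-congʳ (reflexive (P.cong φ (companion-lastRow t i+1≡k))))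

tℕ-suc : ∀ {k} (t : Fin k → ℤ) (i : Fin k) → tℕ t (suc (toℕ i)) ≡ t i
tℕ-suc {k} t i with toℕ i <? k
... | yes i<k = P.cong t (FinP.fromℕ<-toℕ i i<k)
... | no i≮k = ⊥-elim (i≮k (FinP.toℕ<n i))

module Windows {k : ℕ} (t : Fin (suc k) → ℤ) (F : ℤ → ℚ)
  (recurrence : ∀ n → F n ≡ ∑Fin (λ (i : Fin (suc k)) → toℚ (t i) ℚ.* F (n ℤ.- + suc (toℕ i)))) where
  open ℚAction
  open ℚSum using (sum; sum-reverse; sum-single; sum-cong-≋)
  open CompanionAction ℚP.+-*-commutativeRing (λ q → q) (IdMorphism.isRingHomomorphism ℚ.+-*-rawRing P.refl) t
  open P.≡-Reasoning
  open import Algebra.Properties.Group ℚP.+-0-group using (∙-cancelʳ)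

  A : Mat (suc k)
  A = companion (suc k) t

  window : ℤ → Fin (suc k) → ℚ
  window m i = F (m ℤ.+ + toℕ i)

  companion-window-lastRow : ∀ m i → suc (toℕ i) ≡ suc k → (A ⊙ window m) i ≡ window (m ℤ.+ + 1) i
  companion-window-lastRow m i i+1≡k+1 = begin
    (A ⊙ window m) i                                                   ≡⟨ companion-⊙-last (window m) i+1≡k+1 ⟩
    sum (λ (l : Fin (suc k)) → toℚ (tℕ t (suc k ∸ toℕ l)) ℚ.* F (m ℤ.+ + toℕ l))
      ≡⟨ sum-reverse {suc k} (λ l → toℚ (tℕ t (suc k ∸ toℕ l)) ℚ.* F (m ℤ.+ + toℕ l)) ⟨
    sum (λ (j : Fin (suc k)) → toℚ (tℕ t (suc k ∸ toℕ (opposite j))) ℚ.* F (m ℤ.+ + toℕ (opposite j)))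
                                                                        ≡⟨ sum-cong-≋ {suc k} (λ j → P.cong₂ ℚ._*_
                                                                            (coefficient j) (P.cong F (index j))) ⟩
    sum (λ (j : Fin (suc k)) → toℚ (t j) ℚ.* F ((m ℤ.+ + suc k) ℤ.- + suc (toℕ j)))
      ≡⟨ P.trans (recurrence (m ℤ.+ + suc k)) (∑Fin≡sum {suc k} (λ j → toℚ (t j) ℚ.* F ((m ℤ.+ + suc k) ℤ.- + suc (toℕ j)))) ⟨
    F (m ℤ.+ + suc k)
      ≡⟨ P.cong F (P.trans (P.cong (λ x → m ℤ.+ + x) (P.sym i+1≡k+1))
                                                                             (P.sym (ℤP.+-assoc m (+ 1) (+ toℕ i)))) ⟩
    window (m ℤ.+ + 1) i                                               ∎
    where
    coefficient : ∀ j → toℚ (tℕ t (suc k ∸ toℕ (opposite j))) ≡ toℚ (t j)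
    coefficient j = P.cong toℚ (P.trans (P.cong (λ x → tℕ t (suc k ∸ x)) (FinP.opposite-prop j))
                      (P.trans (P.cong (tℕ t) (ℕP.m∸[m∸n]≡n (FinP.toℕ<n j))) (tℕ-suc t j)))
    index : ∀ j → m ℤ.+ + toℕ (opposite j) ≡ (m ℤ.+ + suc k) ℤ.- + suc (toℕ j)
    index j = begin
      m ℤ.+ + toℕ (opposite j)                 ≡⟨ P.cong (λ x → m ℤ.+ + x) (FinP.opposite-prop j) ⟩
      m ℤ.+ + (suc k ∸ suc (toℕ j))            ≡⟨ P.cong (λ x → m ℤ.+ x) (ℤP.⊖-≥ (FinP.toℕ<n j)) ⟨
      m ℤ.+ (suc k ℤ.⊖ suc (toℕ j))            ≡⟨ P.cong (λ x → m ℤ.+ x) (ℤP.m-n≡m⊖n (suc k) (suc (toℕ j))) ⟨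
      m ℤ.+ (+ suc k ℤ.- + suc (toℕ j))        ≡⟨ ℤP.+-assoc m (+ suc k) (ℤ.- + suc (toℕ j)) ⟨
      (m ℤ.+ + suc k) ℤ.- + suc (toℕ j)        ∎
  companion-window : ∀ m i → (A ⊙ window m) i ≡ window (m ℤ.+ + 1) i
  companion-window m i = byRow (suc (toℕ i) ℕ.≟ suc k)
    where
    byRow : Dec (suc (toℕ i) ≡ suc k) → (A ⊙ window m) i ≡ window (m ℤ.+ + 1) i
    byRow (yes i+1≡k+1) = companion-window-lastRow m i i+1≡k+1
    byRow (no i+1≢k+1)  = P.trans (companion-⊙-shift (window m) i+1<k+1)
      (P.cong F (P.trans (P.cong (λ x → m ℤ.+ + x) (FinP.toℕ-fromℕ< i+1<k+1)) (P.sym (ℤP.+-assoc m (+ 1) (+ toℕ i)))))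
      where
      i+1<k+1 : suc (toℕ i) < suc k
      i+1<k+1 = ℕP.≤∧≢⇒< (FinP.toℕ<n i) i+1≢k+1

  companion^-window : ∀ n m i → ((A ^M n) ⊙ window m) i ≡ window (m ℤ.+ + n) i
  companion^-window zero    m i = P.trans (Id-⊙ (window m) i) (P.cong (λ x → F (x ℤ.+ + toℕ i)) (P.sym (ℤP.+-identityʳ m)))
  companion^-window (suc n) m i = begin
    ((A *M (A ^M n)) ⊙ window m) i ≡⟨ *M-⊙ A (A ^M n) (window m) i ⟩
    (A ⊙ ((A ^M n) ⊙ window m)) i  ≡⟨ ⊙-congʳ A (companion^-window n m) i ⟩
    (A ⊙ window (m ℤ.+ + n)) i     ≡⟨ companion-window (m ℤ.+ + n) i ⟩
    window (m ℤ.+ + n ℤ.+ + 1) i   ≡⟨ P.cong (λ x → F (x ℤ.+ + toℕ i))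
                                         (P.trans (ℤP.+-assoc m (+ n) (+ 1)) (P.cong (λ x → m ℤ.+ + x) (ℕP.+-comm n 1))) ⟩
    window (m ℤ.+ + suc n) i       ∎

  firstRow⇒period : ∀ c → (∀ l → (A ^M c) Fin.zero l ≡ Id Fin.zero l) → ∀ n → F (n ℤ.+ + c) ≡ F n
  firstRow⇒period c firstRow n = begin
    F (n ℤ.+ + c)                    ≡⟨ P.cong F (ℤP.+-identityʳ _) ⟨
    window (n ℤ.+ + c) Fin.zero      ≡⟨ companion^-window c n Fin.zero ⟨
    ((A ^M c) ⊙ window n) Fin.zero   ≡⟨ ⊙-rowCong {X = A ^M c} {Y = Id} {u = window n} {i = Fin.zero} firstRow (λ _ → P.refl) ⟩
    (Id ⊙ window n) Fin.zero         ≡⟨ Id-⊙ (window n) Fin.zero ⟩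
    window n Fin.zero                ≡⟨ P.cong F (ℤP.+-identityʳ _) ⟩
    F n                              ∎

  basis : ℕ → Fin (suc k) → ℚ
  basis j l with toℕ l ℕ.≟ j
  ... | yes _ = 1ℚ
  ... | no _  = 0ℚ

  basis-on : ∀ {j l} → toℕ l ≡ j → basis j l ≡ 1ℚ
  basis-on {j} {l} e with toℕ l ℕ.≟ j
  ... | yes _ = P.refl
  ... | no l≢j = ⊥-elim (l≢j e)

  basis-off : ∀ {j l} → toℕ l ≢ j → basis j l ≡ 0ℚ
  basis-off {j} {l} l≢j with toℕ l ℕ.≟ j
  ... | yes e = ⊥-elim (l≢j e)
  ... | no _  = P.refl

  basis≡Id : ∀ (i j : Fin (suc k)) → basis (toℕ j) i ≡ Id i j
  basis≡Id i j = byIndex (toℕ i ℕ.≟ toℕ j)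
    where
    byIndex : Dec (toℕ i ≡ toℕ j) → basis (toℕ j) i ≡ Id i j
    byIndex (yes e)   = P.trans (basis-on e) (P.sym (P.subst (λ x → Id i x ≡ 1ℚ) (FinP.toℕ-injective e) (Id-diagonal i)))
    byIndex (no i≢j) = P.trans (basis-off i≢j) (P.sym (Id-offDiagonal (i≢j ∘ P.cong toℕ)))

  ⊙-basis : ∀ (X : Mat (suc k)) j i → (X ⊙ basis (toℕ j)) i ≡ X i j
  ⊙-basis X j i = begin
    sum (λ l → X i l ℚ.* basis (toℕ j) l) ≡⟨ sum-single _ j (λ l l≢j →
                                               P.trans (P.cong (X i l ℚ.*_) (basis-off (l≢j ∘ FinP.toℕ-injective)))
                                                       (ℚP.*-zeroʳ (X i l))) ⟩
    X i j ℚ.* basis (toℕ j) j             ≡⟨ P.cong (X i j ℚ.*_) (basis-on {l = j} P.refl) ⟩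
    X i j ℚ.* 1ℚ                          ≡⟨ ℚP.*-identityʳ _ ⟩
    X i j                                 ∎

  companion-basis : ∀ j → j < k → ∀ l → (A ⊙ basis (suc j)) l ≡ basis j l ℚ.+ toℚ (tℕ t (k ∸ j)) ℚ.* basis k l
  companion-basis j j<k l =
    P.trans (P.cong (λ x → (A ⊙ basis x) l) (P.sym toℕJ))
      (P.trans (⊙-basis A J l) (byEntry (suc (toℕ l) ℕ.≟ suc k) (toℕ l ℕ.≟ j)))
    where
    J : Fin (suc k)
    J = fromℕ< (s≤s j<k)
    toℕJ : toℕ J ≡ suc j
    toℕJ = FinP.toℕ-fromℕ< (s≤s j<k)
    T : ℚ
    T = toℚ (tℕ t (k ∸ j))
    byEntry : Dec (suc (toℕ l) ≡ suc k) → Dec (toℕ l ≡ j) → A l J ≡ basis j l ℚ.+ T ℚ.* basis k l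
    byEntry (yes l+1≡k+1) _ = begin
      A l J                           ≡⟨ companion-lastRow t l+1≡k+1 ⟩
      toℚ (tℕ t (suc k ∸ toℕ J))      ≡⟨ P.cong (λ x → toℚ (tℕ t (suc k ∸ x))) toℕJ ⟩
      T                               ≡⟨ ℚP.*-identityʳ T ⟨
      T ℚ.* 1ℚ                        ≡⟨ P.cong (T ℚ.*_) (basis-on (ℕP.suc-injective l+1≡k+1)) ⟨
      T ℚ.* basis k l                 ≡⟨ ℚP.+-identityˡ _ ⟨
      0ℚ ℚ.+ T ℚ.* basis k l          ≡⟨ P.cong (ℚ._+ T ℚ.* basis k l) (basis-off l≢j) ⟨
      basis j l ℚ.+ T ℚ.* basis k l   ∎
      where
      l≢j : toℕ l ≢ j
      l≢j l≡j = ℕP.<-irrefl (P.trans (P.sym l≡j) (ℕP.suc-injective l+1≡k+1)) j<k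
    byEntry (no l+1≢k+1) (yes l≡j) = begin
      A l J                           ≡⟨ companion-superdiagonal t (P.trans toℕJ (P.cong suc (P.sym l≡j))) ⟩
      1ℚ                              ≡⟨ P.cong₂ ℚ._+_ (basis-on l≡j) (P.trans (P.cong (T ℚ.*_) (basis-off l≢k)) (ℚP.*-zeroʳ T)) ⟨
      basis j l ℚ.+ T ℚ.* basis k l   ∎
      where
      l≢k : toℕ l ≢ k
      l≢k = l+1≢k+1 ∘ P.cong suc
    byEntry (no l+1≢k+1) (no l≢j) = begin
      A l J                           ≡⟨ companion-elsewhere t l+1≢k+1 (λ e → l≢j (ℕP.suc-injective (P.trans (P.sym e) toℕJ))) ⟩
      0ℚ
        ≡⟨ P.cong₂ ℚ._+_ (basis-off l≢j) (P.trans (P.cong (T ℚ.*_) (basis-off (l+1≢k+1 ∘ P.cong suc))) (ℚP.*-zeroʳ T)) ⟨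
      basis j l ℚ.+ T ℚ.* basis k l   ∎

  -- Aᶜ commutes with A and fixes  basis k = window (-k); since  A (basis (j+1)) = basis j + tₖ₋ⱼ (basis k),
  -- downward induction shows that Aᶜ fixes every basis vector.
  period⇒order : ∀ c → (∀ l → window (ℤ.- + k) l ≡ basis k l) → (∀ n → F (n ℤ.+ + c) ≡ F n) → (A ^M c) ≈M Id
  period⇒order c initial periodic i j = begin
    B i j                     ≡⟨ ⊙-basis B j i ⟨
    (B ⊙ basis (toℕ j)) i     ≡⟨ fixes-basis (k ∸ toℕ j) (toℕ j) (ℕP.m+[n∸m]≡n (ℕ.s≤s⁻¹ (FinP.toℕ<n j))) i ⟩
    basis (toℕ j) i           ≡⟨ basis≡Id i j ⟩
    Id i j                    ∎
    where
    B : Mat (suc k)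
    B = A ^M c
    fixes-window : ∀ m l → (B ⊙ window m) l ≡ window m l
    fixes-window m l = P.trans (companion^-window c m l) (P.trans (P.cong F (begin
      m ℤ.+ + c ℤ.+ + toℕ l     ≡⟨ ℤP.+-assoc m (+ c) (+ toℕ l) ⟩
      m ℤ.+ (+ c ℤ.+ + toℕ l)   ≡⟨ P.cong (λ x → m ℤ.+ x) (ℤP.+-comm (+ c) (+ toℕ l)) ⟩
      m ℤ.+ (+ toℕ l ℤ.+ + c)   ≡⟨ ℤP.+-assoc m (+ toℕ l) (+ c) ⟨
      m ℤ.+ + toℕ l ℤ.+ + c     ∎)) (periodic _))
    fixes-last : ∀ l → (B ⊙ basis k) l ≡ basis k l
    fixes-last l = P.trans (⊙-congʳ B (λ l' → P.sym (initial l')) l) (P.trans (fixes-window (ℤ.- + k) l) (initial l))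
    fixes-basis : ∀ d j → j ℕ.+ d ≡ k → ∀ l → (B ⊙ basis j) l ≡ basis j l
    fixes-basis zero    j j+0≡k l = P.subst (λ x → (B ⊙ basis x) l ≡ basis x l)
                                            (P.trans (P.sym j+0≡k) (ℕP.+-identityʳ j)) (fixes-last l)
    fixes-basis (suc d) j j+d+1≡k l = ∙-cancelʳ (T ℚ.* basis k l) ((B ⊙ basis j) l) (basis j l) (begin
      (B ⊙ basis j) l ℚ.+ T ℚ.* basis k l                      ≡⟨ P.cong (λ x → (B ⊙ basis j) l ℚ.+ T ℚ.* x) (fixes-last l) ⟨
      (B ⊙ basis j) l ℚ.+ T ℚ.* (B ⊙ basis k) l                ≡⟨ P.cong ((B ⊙ basis j) l ℚ.+_) (⊙-* B T (basis k) l) ⟨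
      (B ⊙ basis j) l ℚ.+ (B ⊙ (λ l' → T ℚ.* basis k l')) l    ≡⟨ ⊙-+ B (basis j) (λ l' → T ℚ.* basis k l') l ⟨
      (B ⊙ (λ l' → basis j l' ℚ.+ T ℚ.* basis k l')) l         ≡⟨ ⊙-congʳ B (λ l' → P.sym (companion-basis j j<k l')) l ⟩
      (B ⊙ (A ⊙ basis (suc j))) l                              ≡⟨ ^M-⊙-comm A c (basis (suc j)) l ⟩
      (A ⊙ (B ⊙ basis (suc j))) l
        ≡⟨ ⊙-congʳ A (fixes-basis d (suc j) (P.trans (P.sym (ℕP.+-suc j d)) j+d+1≡k)) l ⟩
      (A ⊙ basis (suc j)) l                                    ≡⟨ companion-basis j j<k l ⟩
      basis j l ℚ.+ T ℚ.* basis k l                            ∎)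
      where
      j<k : j < k
      j<k = P.subst (j <_) j+d+1≡k (ℕP.m<m+n j (s≤s z≤n))
      T : ℚ
      T = toℚ (tℕ t (k ∸ j))

module FibonacciPolynomials where
  open P using (refl; sym; trans; cong; cong₂; subst; module ≡-Reasoning)

  listSum : {A : Set} → (A → ℤ) → List A → ℤ
  listSum f xs = foldr ℤ._+_ (+ 0) (map f xs)

  listSum-++ : {A : Set} (f : A → ℤ) (xs ys : List A) → listSum f (xs ++ ys) ≡ listSum f xs ℤ.+ listSum f ys
  listSum-++ f [] ys = sym (ℤP.+-identityˡ _)
  listSum-++ f (x ∷ xs) ys = trans (cong (λ y → f x ℤ.+ y) (listSum-++ f xs ys)) (sym (ℤP.+-assoc (f x) _ _))

  listSum-concatMap : {A B : Set} (f : B → ℤ) (g : A → List B) (xs : List A) →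
    listSum f (concatMap g xs) ≡ listSum (λ a → listSum f (g a)) xs
  listSum-concatMap f g [] = refl
  listSum-concatMap f g (x ∷ xs) = trans (listSum-++ f (g x) (concatMap g xs))
      (cong (λ y → listSum f (g x) ℤ.+ y) (listSum-concatMap f g xs))

  listSum-map : {A B : Set} (f : B → ℤ) (g : A → B) (xs : List A) → listSum f (map g xs) ≡ listSum (f ∘ g) xs
  listSum-map f g [] = refl
  listSum-map f g (x ∷ xs) = cong (λ y → f (g x) ℤ.+ y) (listSum-map f g xs)

  listSum-cong : {A : Set} {f g : A → ℤ} (xs : List A) → (∀ x → f x ≡ g x) → listSum f xs ≡ listSum g xs
  listSum-cong [] e = refl
  listSum-cong (x ∷ xs) e = cong₂ ℤ._+_ (e x) (listSum-cong xs e)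

  *-distribˡ-listSum : {A : Set} (c : ℤ) (f : A → ℤ) (xs : List A) → c ℤ.* listSum f xs ≡ listSum (λ x → c ℤ.* f x) xs
  *-distribˡ-listSum c f [] = ℤP.*-zeroʳ c
  *-distribˡ-listSum c f (x ∷ xs) = trans (ℤP.*-distribˡ-+ c (f x) _) (cong (λ y → c ℤ.* f x ℤ.+ y) (*-distribˡ-listSum c f xs))

  listSum-zero : {A : Set} {f : A → ℤ} (xs : List A) → (∀ x → f x ≡ + 0) → listSum f xs ≡ + 0
  listSum-zero [] e = refl
  listSum-zero (x ∷ xs) e = trans (cong₂ ℤ._+_ (e x) (listSum-zero xs e)) refl

  rangeSum : ℕ → (ℕ → ℤ) → ℤ
  rangeSum N h = ℤSum.sum (λ (i : Fin N) → h (toℕ i))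

  listSum-applyUpTo : (h : ℕ → ℤ) (f : ℕ → ℕ) (N : ℕ) → listSum h (applyUpTo f N) ≡ rangeSum N (h ∘ f)
  listSum-applyUpTo h f zero = refl
  listSum-applyUpTo h f (suc N) = cong (λ y → h (f 0) ℤ.+ y) (listSum-applyUpTo h (f ∘ suc) N)

  rangeSum-cong : (N : ℕ) {h g : ℕ → ℤ} → (∀ a → a < N → h a ≡ g a) → rangeSum N h ≡ rangeSum N g
  rangeSum-cong N e = ℤSum.sum-cong-≋ {N} (λ i → e (toℕ i) (FinP.toℕ<n i))

  rangeSum-snoc : (N : ℕ) (h : ℕ → ℤ) → rangeSum (suc N) h ≡ rangeSum N h ℤ.+ h N
  rangeSum-snoc N h = trans (ℤSum.sum-init-last {N} (λ i → h (toℕ i)))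
    (cong₂ ℤ._+_ (ℤSum.sum-cong-≋ {N} (λ i → cong h (FinP.toℕ-inject₁ i))) (cong h (FinP.toℕ-fromℕ N)))

  rangeSum-extend : (N d : ℕ) (h : ℕ → ℤ) → (∀ a → N ≤ a → h a ≡ + 0) → rangeSum (N ℕ.+ d) h ≡ rangeSum N h
  rangeSum-extend N zero h e = cong (λ x → rangeSum x h) (ℕP.+-identityʳ N)
  rangeSum-extend N (suc d) h e = begin
    rangeSum (N ℕ.+ suc d) h ≡⟨ cong (λ x → rangeSum x h) (ℕP.+-suc N d) ⟩
    rangeSum (suc (N ℕ.+ d)) h ≡⟨ rangeSum-snoc (N ℕ.+ d) h ⟩
    rangeSum (N ℕ.+ d) h ℤ.+ h (N ℕ.+ d) ≡⟨ cong₂ ℤ._+_ (rangeSum-extend N d h e) (e _ (ℕP.m≤m+n N d)) ⟩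
    rangeSum N h ℤ.+ + 0 ≡⟨ ℤP.+-identityʳ _ ⟩
    rangeSum N h ∎
    where open ≡-Reasoning

  rangeSum-shrink : (N M : ℕ) (h : ℕ → ℤ) → N ≤ M → (∀ a → N ≤ a → h a ≡ + 0) → rangeSum M h ≡ rangeSum N h
  rangeSum-shrink N M h le e = trans (cong (λ x → rangeSum x h) (sym (ℕP.m+[n∸m]≡n le))) (rangeSum-extend N (M ∸ N) h e)

  rangeSum-zero : (N : ℕ) {h : ℕ → ℤ} → (∀ a → h a ≡ + 0) → rangeSum N h ≡ + 0
  rangeSum-zero N e = ℤSum.sum-zero {N} (λ i → e (toℕ i))

  when : {P : Set} → Dec P → ℤ → ℤ
  when (yes _) x = x
  when (no _) x = + 0

  when-yes : {P : Set} (d : Dec P) {x : ℤ} → P → when d x ≡ x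
  when-yes (yes _) p = refl
  when-yes (no ¬p) p = ⊥-elim (¬p p)

  when-no : {P : Set} (d : Dec P) {x : ℤ} → ¬ P → when d x ≡ + 0
  when-no (yes p) ¬p = ⊥-elim (¬p p)
  when-no (no _) ¬p = refl

  when-*ˡ : {P : Set} (d : Dec P) (c x : ℤ) → when d (c ℤ.* x) ≡ c ℤ.* when d x
  when-*ˡ (yes _) c x = refl
  when-*ˡ (no _) c x = sym (ℤP.*-zeroʳ c)

  when-rangeSum : {P : Set} (d : Dec P) (N : ℕ) (h : ℕ → ℤ) → when d (rangeSum N h) ≡ rangeSum N (λ a → when d (h a))
  when-rangeSum (yes _) N h = refl
  when-rangeSum (no _) N h = sym (rangeSum-zero N (λ a → refl))

  when-⇔ : {P Q : Set} (d : Dec P) (d' : Dec Q) {x y : ℤ} → (P → Q) → (Q → P) → (P → x ≡ y) → when d x ≡ when d' y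
  when-⇔ (yes p) (yes q) f g e = e p
  when-⇔ (yes p) (no ¬q) f g e = ⊥-elim (¬q (f p))
  when-⇔ (no ¬p) (yes q) f g e = ⊥-elim (¬p (g q))
  when-⇔ (no _) (no _) f g e = refl

  when-0 : {P : Set} (d : Dec P) → when d (+ 0) ≡ + 0
  when-0 (yes _) = refl
  when-0 (no _) = refl

  when-+ : {P : Set} (d : Dec P) (x y : ℤ) → when d (x ℤ.+ y) ≡ when d x ℤ.+ when d y
  when-+ (yes _) x y = refl
  when-+ (no _) x y = refl

  when-comm : {P Q : Set} (d : Dec P) (e : Dec Q) (x : ℤ) → when d (when e x) ≡ when e (when d x)
  when-comm (yes _) (yes _) x = refl
  when-comm (yes _) (no _) x = refl
  when-comm (no _) (yes _) x = refl
  when-comm (no _) (no _) x = refl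

  when-× : {P R Q : Set} (d1 : Dec P) (d3 : Dec R) (d' : Dec Q) {x y : ℤ} → (P → R → Q) → (Q → P) → (Q → R) → (Q → x ≡ y) →
           when d1 (when d3 x) ≡ when d' y
  when-× (yes p) (yes r) (yes q) f g h e = e q
  when-× (yes p) (yes r) (no ¬q) f g h e = ⊥-elim (¬q (f p r))
  when-× (yes p) (no ¬r) (yes q) f g h e = ⊥-elim (¬r (h q))
  when-× (yes p) (no ¬r) (no ¬q) f g h e = refl
  when-× (no ¬p) d3 (yes q) f g h e = ⊥-elim (¬p (g q))
  when-× (no ¬p) d3 (no ¬q) f g h e = refl

  keepIf : {P B : Set} → Dec P → List B → List B
  keepIf (yes _) xs = xs
  keepIf (no _) xs = []

  listSum-keepIf : {P B : Set} (f : B → ℤ) (d : Dec P) (xs : List B) → listSum f (keepIf d xs) ≡ when d (listSum f xs)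
  listSum-keepIf f (yes _) xs = refl
  listSum-keepIf f (no _) xs = refl

  -- The left-hand side of sols-step is the local function of the definition of sols, which cannot be named.
  mutual
    sols-unfold : (w m n : ℕ) → sols w (suc m) n ≡
      concatMap (λ a → keepIf (suc w ℕ.* a ≤? n) (map (a ∷_) (sols (suc w) m (n ∸ suc w ℕ.* a)))) (upTo (suc n))
    sols-unfold w m n = concatMap-cong (sols-step w m n) (upTo (suc n))

    sols-step : ∀ w m n a → _ ≡ keepIf (suc w ℕ.* a ≤? n) (map (a ∷_) (sols (suc w) m (n ∸ suc w ℕ.* a)))
    sols-step w m n a with suc w ℕ.* a ≤? n
    ... | yes _ = refl
    ... | no _  = refl

  ≤∸-swap : ∀ {l s n} → l ≤ n ∸ s → s ≤ n → s ≤ n ∸ l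
  ≤∸-swap {l} {s} {n} h s≤n = ℕP.m+n≤o⇒m≤o∸n s (subst (ℕ._≤ n) (ℕP.+-comm l s) (ℕP.m≤o∸n⇒m+n≤o l s≤n h))

  ≤∸⇒≤ : ∀ {s l n} → s ≤ n ∸ l → s ≤ n
  ≤∸⇒≤ {s} {l} {n} h = ℕP.≤-trans h (ℕP.m∸n≤m n l)

  [n∸s]∸l≡[n∸l]∸s : ∀ n s l → (n ∸ s) ∸ l ≡ (n ∸ l) ∸ s
  [n∸s]∸l≡[n∸l]∸s n s l = trans (ℕP.∸-+-assoc n s l) (trans (cong (n ∸_) (ℕP.+-comm s l)) (sym (ℕP.∸-+-assoc n l s)))

  c·x·yz≡y·c·xz : ∀ (c x y z : ℤ) → c ℤ.* (x ℤ.* (y ℤ.* z)) ≡ y ℤ.* (c ℤ.* (x ℤ.* z))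
  c·x·yz≡y·c·xz = ℤSolver.solve-∀

  c·xy·z≡x·c·yz : ∀ (c x y z : ℤ) → c ℤ.* ((x ℤ.* y) ℤ.* z) ≡ x ℤ.* (c ℤ.* (y ℤ.* z))
  c·xy·z≡x·c·yz = ℤSolver.solve-∀

  xy·zu≡x·z·yu : ∀ (x y z u : ℤ) → (x ℤ.* y) ℤ.* (z ℤ.* u) ≡ x ℤ.* (z ℤ.* (y ℤ.* u))
  xy·zu≡x·z·yu = ℤSolver.solve-∀

  listSum-sols-cong : ∀ m w n (f g : Vec ℕ m → ℤ) → (∀ α → vsum α ≤ n → f α ≡ g α) → listSum f (sols w m n) ≡ listSum g (sols w m n)
  listSum-sols-cong zero w zero f g e = cong (ℤ._+ + 0) (e [] z≤n)
  listSum-sols-cong zero w (suc n) f g e = refl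
  listSum-sols-cong (suc m) w n f g e = begin
    listSum f (sols w (suc m) n) ≡⟨ cong (listSum f) (sols-unfold w m n) ⟩
    listSum f (concatMap G (upTo (suc n))) ≡⟨ listSum-concatMap f G (upTo (suc n)) ⟩
    listSum (λ a → listSum f (G a)) (upTo (suc n))
      ≡⟨ listSum-cong (upTo (suc n)) (λ a → trans (listSum-keepIf f (suc w ℕ.* a ≤? n) _)
          (trans (byCase a (suc w ℕ.* a ≤? n)) (sym (listSum-keepIf g (suc w ℕ.* a ≤? n) _)))) ⟩
    listSum (λ a → listSum g (G a)) (upTo (suc n)) ≡⟨ sym (listSum-concatMap g G (upTo (suc n))) ⟩
    listSum g (concatMap G (upTo (suc n))) ≡⟨ cong (listSum g) (sym (sols-unfold w m n)) ⟩
    listSum g (sols w (suc m) n) ∎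
    where
    open ≡-Reasoning
    G : ℕ → List (Vec ℕ (suc m))
    G a = keepIf (suc w ℕ.* a ≤? n) (map (a ∷_) (sols (suc w) m (n ∸ suc w ℕ.* a)))
    byCase : ∀ a (d : Dec (suc w ℕ.* a ≤ n)) → when d (listSum f (map (a ∷_) (sols (suc w) m (n ∸ suc w ℕ.* a)))) ≡ when d
        (listSum g (map (a ∷_) (sols (suc w) m (n ∸ suc w ℕ.* a))))
    byCase a (yes p) = trans (listSum-map f (a ∷_) ys) (trans
        (listSum-sols-cong m (suc w) (n ∸ suc w ℕ.* a) (λ β → f (a ∷ β)) (λ β → g (a ∷ β))
                      (λ β h → e (a ∷ β) (bound β h))) (sym (listSum-map g (a ∷_) ys)))
      where
      ys = sols (suc w) m (n ∸ suc w ℕ.* a)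
      bound : ∀ β → vsum β ≤ n ∸ suc w ℕ.* a → a ℕ.+ vsum β ≤ n
      bound β h = ℕP.≤-trans (ℕP.+-mono-≤ (ℕP.m≤n*m a (suc w)) h) (ℕP.≤-reflexive (ℕP.m+[n∸m]≡n p))
    byCase a (no _) = refl

  listSum-rangeSum : {A : Set} (N : ℕ) (h : A → ℕ → ℤ) (xs : List A) → listSum (λ α → rangeSum N (h α)) xs ≡ rangeSum N
      (λ j → listSum (λ α → h α j) xs)
  listSum-rangeSum N h [] = sym (rangeSum-zero N (λ _ → refl))
  listSum-rangeSum N h (x ∷ xs) = trans (cong (λ y → rangeSum N (h x) ℤ.+ y) (listSum-rangeSum N h xs))
      (sym (ℤSum.∑-distrib-+ {N} (λ j → h x (toℕ j)) (λ j → listSum (λ α → h α (toℕ j)) xs)))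

  module Layers {k : ℕ} (t : Fin k → ℤ) where

    weighted : (w : ℕ) {m : ℕ} → Vec ℕ m → ℤ
    weighted w α = + multinom α ℤ.* monom t w α

    -- layer w m n j is the part of the defining sum in the variables t_{w+1}, …, t_{w+m} coming from the α
    -- with |α| = j. Pascal's rule for the first binomial factor of multinom gives a recurrence in j
    -- (layer-recurrence), and summing it over j gives the recurrence of F_{k,n}.
    layer : (w m n j : ℕ) → ℤ
    layer w m n j = listSum (λ α → when (vsum α ℕ.≟ j) (weighted w α)) (sols w m n)

    shiftedLayer : (w m n l j : ℕ) → ℤ
    shiftedLayer w m n l j = when (l ≤? n) (layer w m (n ∸ l) j)

    weighted-cons : ∀ w a {m} (β : Vec ℕ m) →
                    weighted w (a ∷ β) ≡ + ((a ℕ.+ vsum β) C a) ℤ.* (tℕ t (suc w) ℤ.^ a ℤ.* weighted (suc w) β)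
    weighted-cons w a β = begin
      + (((a ℕ.+ vsum β) C a) ℕ.* multinom β) ℤ.* (T ℤ.^ a ℤ.* monom t (suc w) β)
        ≡⟨ cong (ℤ._* (T ℤ.^ a ℤ.* monom t (suc w) β)) (ℤP.pos-* ((a ℕ.+ vsum β) C a) (multinom β)) ⟩
      (+ ((a ℕ.+ vsum β) C a) ℤ.* + multinom β) ℤ.* (T ℤ.^ a ℤ.* monom t (suc w) β)
        ≡⟨ xy·zu≡x·z·yu (+ ((a ℕ.+ vsum β) C a)) (+ multinom β) (T ℤ.^ a) (monom t (suc w) β) ⟩
      + ((a ℕ.+ vsum β) C a) ℤ.* (T ℤ.^ a ℤ.* weighted (suc w) β) ∎
      where
      open ≡-Reasoning
      T : ℤ
      T = tℕ t (suc w)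

    layer-cons : ∀ w a j {m} (ys : List (Vec ℕ m)) →
                 listSum (λ β → when (a ℕ.+ vsum β ℕ.≟ j) (weighted w (a ∷ β))) ys ≡
                 when (a ≤? j) (+ (j C a) ℤ.* (tℕ t (suc w) ℤ.^ a ℤ.* listSum (λ β → when (vsum β ℕ.≟ j ∸ a) (weighted (suc w) β)) ys))
    layer-cons w a j ys with a ≤? j
    ... | no a≰j  = listSum-zero ys (λ β → when-no (a ℕ.+ vsum β ℕ.≟ j) (λ e → a≰j (subst (a ≤_) e (ℕP.m≤m+n a (vsum β)))))
    ... | yes a≤j = begin
      listSum (λ β → when (a ℕ.+ vsum β ℕ.≟ j) (weighted w (a ∷ β))) ys
        ≡⟨ listSum-cong ys term ⟩
      listSum (λ β → + (j C a) ℤ.* (T ℤ.^ a ℤ.* when (vsum β ℕ.≟ j ∸ a) (weighted (suc w) β))) ys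
        ≡⟨ sym (*-distribˡ-listSum (+ (j C a)) _ ys) ⟩
      + (j C a) ℤ.* listSum (λ β → T ℤ.^ a ℤ.* when (vsum β ℕ.≟ j ∸ a) (weighted (suc w) β)) ys
        ≡⟨ cong (+ (j C a) ℤ.*_) (sym (*-distribˡ-listSum (T ℤ.^ a) _ ys)) ⟩
      + (j C a) ℤ.* (T ℤ.^ a ℤ.* listSum (λ β → when (vsum β ℕ.≟ j ∸ a) (weighted (suc w) β)) ys) ∎
      where
      open ≡-Reasoning
      T : ℤ
      T = tℕ t (suc w)
      term : ∀ β → when (a ℕ.+ vsum β ℕ.≟ j) (weighted w (a ∷ β)) ≡
                   + (j C a) ℤ.* (T ℤ.^ a ℤ.* when (vsum β ℕ.≟ j ∸ a) (weighted (suc w) β))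
      term β = begin
        when (a ℕ.+ vsum β ℕ.≟ j) (weighted w (a ∷ β))
          ≡⟨ when-⇔ (a ℕ.+ vsum β ℕ.≟ j) (vsum β ℕ.≟ j ∸ a)
               (λ e → trans (sym (ℕP.m+n∸m≡n a (vsum β))) (cong (_∸ a) e))
               (λ e → trans (cong (a ℕ.+_) e) (ℕP.m+[n∸m]≡n a≤j))
               (λ e → trans (weighted-cons w a β) (cong (λ x → + (x C a) ℤ.* (T ℤ.^ a ℤ.* weighted (suc w) β)) e)) ⟩
        when (vsum β ℕ.≟ j ∸ a) (+ (j C a) ℤ.* (T ℤ.^ a ℤ.* weighted (suc w) β))
          ≡⟨ when-*ˡ (vsum β ℕ.≟ j ∸ a) (+ (j C a)) (T ℤ.^ a ℤ.* weighted (suc w) β) ⟩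
        + (j C a) ℤ.* when (vsum β ℕ.≟ j ∸ a) (T ℤ.^ a ℤ.* weighted (suc w) β)
          ≡⟨ cong (+ (j C a) ℤ.*_) (when-*ˡ (vsum β ℕ.≟ j ∸ a) (T ℤ.^ a) (weighted (suc w) β)) ⟩
        + (j C a) ℤ.* (T ℤ.^ a ℤ.* when (vsum β ℕ.≟ j ∸ a) (weighted (suc w) β)) ∎

    layer-suc : ∀ w m n j → layer w (suc m) n j ≡
      rangeSum (suc n) (λ a → when (suc w ℕ.* a ≤? n) (when (a ≤? j)
         (+ (j C a) ℤ.* (tℕ t (suc w) ℤ.^ a ℤ.* layer (suc w) m (n ∸ suc w ℕ.* a) (j ∸ a)))))
    layer-suc w m n j = begin
      layer w (suc m) n j                              ≡⟨ cong (listSum f) (sols-unfold w m n) ⟩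
      listSum f (concatMap G (upTo (suc n)))           ≡⟨ listSum-concatMap f G (upTo (suc n)) ⟩
      listSum (λ a → listSum f (G a)) (upTo (suc n))   ≡⟨ listSum-applyUpTo (λ a → listSum f (G a)) (λ x → x) (suc n) ⟩
      rangeSum (suc n) (λ a → listSum f (G a))         ≡⟨ rangeSum-cong (suc n) (λ a _ → term a) ⟩
      _                                                ∎
      where
      open ≡-Reasoning
      f : Vec ℕ (suc m) → ℤ
      f α = when (vsum α ℕ.≟ j) (weighted w α)
      G : ℕ → List (Vec ℕ (suc m))
      G a = keepIf (suc w ℕ.* a ≤? n) (map (a ∷_) (sols (suc w) m (n ∸ suc w ℕ.* a)))
      term : ∀ a → listSum f (G a) ≡ when (suc w ℕ.* a ≤? n) (when (a ≤? j)
         (+ (j C a) ℤ.* (tℕ t (suc w) ℤ.^ a ℤ.* layer (suc w) m (n ∸ suc w ℕ.* a) (j ∸ a))))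
      term a = trans (listSum-keepIf f (suc w ℕ.* a ≤? n) _)
                 (cong (when (suc w ℕ.* a ≤? n)) (trans (listSum-map f (a ∷_) ys) (layer-cons w a j ys)))
        where
        ys : List (Vec ℕ m)
        ys = sols (suc w) m (n ∸ suc w ℕ.* a)

    layer-zero : ∀ m w n → layer w m n 0 ≡ when (n ℕ.≟ 0) (+ 1)
    layer-zero zero w zero = refl
    layer-zero zero w (suc n) = refl
    layer-zero (suc m) w n = begin
      layer w (suc m) n 0 ≡⟨ layer-suc w m n 0 ⟩
      h 0 ℤ.+ rangeSum n (λ b → h (suc b)) ≡⟨ cong₂ ℤ._+_ h0 (rangeSum-zero n (λ b → when-0 (suc w ℕ.* suc b ≤? n))) ⟩
      when (n ℕ.≟ 0) (+ 1) ℤ.+ + 0 ≡⟨ ℤP.+-identityʳ _ ⟩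
      when (n ℕ.≟ 0) (+ 1) ∎
      where
      open ≡-Reasoning
      h : ℕ → ℤ
      h a = when (suc w ℕ.* a ≤? n) (when (a ≤? 0)
         (+ (0 C a) ℤ.* (tℕ t (suc w) ℤ.^ a ℤ.* layer (suc w) m (n ∸ suc w ℕ.* a) (0 ∸ a))))
      h0 : h 0 ≡ when (n ℕ.≟ 0) (+ 1)
      h0 = begin
        h 0 ≡⟨ when-yes (suc w ℕ.* 0 ≤? n) (subst (ℕ._≤ n) (sym (ℕP.*-zeroʳ (suc w))) z≤n) ⟩
        + 1 ℤ.* (+ 1 ℤ.* layer (suc w) m (n ∸ suc w ℕ.* 0) 0) ≡⟨ trans (ℤP.*-identityˡ _) (ℤP.*-identityˡ _) ⟩
        layer (suc w) m (n ∸ suc w ℕ.* 0) 0 ≡⟨ cong (λ x → layer (suc w) m (n ∸ x) 0) (ℕP.*-zeroʳ (suc w)) ⟩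
        layer (suc w) m n 0 ≡⟨ layer-zero m (suc w) n ⟩
        when (n ℕ.≟ 0) (+ 1) ∎

    -- Pascal's rule splits the summand of layer-suc at level j + 1 into a part at level j, which the
    -- induction hypothesis (on m) rewrites through t_{w+2}, t_{w+3}, …, and a part that is t_{w+1} times
    -- the layer of n - (w + 1).
    module LayerRecurrence (w m n j : ℕ)
      (ih : ∀ n' j' → layer (suc w) m n' (suc j') ≡ rangeSum m
          (λ i → tℕ t (suc (suc w) ℕ.+ i) ℤ.* shiftedLayer (suc w) m n' (suc (suc w) ℕ.+ i) j')) where
      sw : ℕ
      sw = suc w
      T : ℤ
      T = tℕ t sw
      layer′ : ℕ → ℕ → ℤ
      layer′ = layer sw m

      summand summandˡ summandʳ : ℕ → ℤ
      summand a = when (sw ℕ.* a ≤? n) (when (a ≤? suc j) (+ (suc j C a) ℤ.* (T ℤ.^ a ℤ.* layer′ (n ∸ sw ℕ.* a) (suc j ∸ a))))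
      summandˡ a = when (sw ℕ.* a ≤? n) (when (a ≤? j) (+ (j C a) ℤ.* (T ℤ.^ a ℤ.* layer′ (n ∸ sw ℕ.* a) (suc (j ∸ a)))))
      summandʳ zero = + 0
      summandʳ (suc b) = when (sw ℕ.* suc b ≤? n) (when (b ≤? j) (+ (j C b) ℤ.* (T ℤ.^ suc b ℤ.* layer′ (n ∸ sw ℕ.* suc b) (j ∸ b))))

      summand-pascal : ∀ a → summand a ≡ summandˡ a ℤ.+ summandʳ a
      summand-pascal zero = sym (ℤP.+-identityʳ _)
      summand-pascal (suc b) = trans (cong (when (sw ℕ.* suc b ≤? n)) (pascal (suc b ≤? suc j) (suc b ≤? j) (b ≤? j)))
          (when-+ (sw ℕ.* suc b ≤? n) _ _)
        where
        Z : ℤ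
        Z = T ℤ.^ suc b ℤ.* layer′ (n ∸ sw ℕ.* suc b) (j ∸ b)
        pascal : (d1 : Dec (suc b ≤ suc j)) (d2 : Dec (suc b ≤ j)) (d3 : Dec (b ≤ j)) →
          when d1 (+ (suc j C suc b) ℤ.* Z) ≡
          when d2 (+ (j C suc b) ℤ.* (T ℤ.^ suc b ℤ.* layer′ (n ∸ sw ℕ.* suc b) (suc (j ∸ suc b)))) ℤ.+ when d3 (+ (j C b) ℤ.* Z)
        pascal d1 d2 (yes b≤j) = begin
          when d1 (+ (suc j C suc b) ℤ.* Z) ≡⟨ when-yes d1 (s≤s b≤j) ⟩
          + (suc j C suc b) ℤ.* Z ≡⟨ cong (λ x → + x ℤ.* Z) (sym (ℕC.nCk+nC[k+1]≡[n+1]C[k+1] j b)) ⟩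
          + ((j C b) ℕ.+ (j C suc b)) ℤ.* Z ≡⟨ ℤP.*-distribʳ-+ Z (+ (j C b)) (+ (j C suc b)) ⟩
          + (j C b) ℤ.* Z ℤ.+ + (j C suc b) ℤ.* Z ≡⟨ ℤP.+-comm (+ (j C b) ℤ.* Z) (+ (j C suc b) ℤ.* Z) ⟩
          + (j C suc b) ℤ.* Z ℤ.+ + (j C b) ℤ.* Z ≡⟨ cong₂ ℤ._+_ (byCase d2) (sym (when-yes (yes b≤j) b≤j)) ⟩
          when d2 (+ (j C suc b) ℤ.* (T ℤ.^ suc b ℤ.* layer′ (n ∸ sw ℕ.* suc b) (suc (j ∸ suc b)))) ℤ.+ when (yes b≤j) (+ (j C b) ℤ.* Z) ∎
          where
          open ≡-Reasoning
          byCase : (d2 : Dec (suc b ≤ j)) → + (j C suc b) ℤ.* Z ≡ when d2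
              (+ (j C suc b) ℤ.* (T ℤ.^ suc b ℤ.* layer′ (n ∸ sw ℕ.* suc b) (suc (j ∸ suc b))))
          byCase (yes sb≤j) = cong (λ x → + (j C suc b) ℤ.* (T ℤ.^ suc b ℤ.* layer′ (n ∸ sw ℕ.* suc b) x)) (ℕP.+-∸-assoc 1 sb≤j)
          byCase (no sb≰j) = trans (cong (λ x → + x ℤ.* Z) (ℕC.k>n⇒nCk≡0 (ℕP.≰⇒> sb≰j))) (ℤP.*-zeroˡ Z)
        pascal d1 d2 (no b≰j) = begin
          when d1 (+ (suc j C suc b) ℤ.* Z) ≡⟨ when-no d1 (λ p → b≰j (ℕ.s≤s⁻¹ p)) ⟩
          + 0 ≡⟨⟩
          + 0 ℤ.+ + 0 ≡⟨ cong₂ ℤ._+_ (sym (when-no d2 (λ p → b≰j (ℕP.≤-trans (ℕP.n≤1+n b) p)))) refl ⟩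
          when d2 (+ (j C suc b) ℤ.* (T ℤ.^ suc b ℤ.* layer′ (n ∸ sw ℕ.* suc b) (suc (j ∸ suc b)))) ℤ.+ when (no b≰j) (+ (j C b) ℤ.* Z) ∎
          where open ≡-Reasoning

      shiftedSummand : ℕ → ℕ → ℤ
      shiftedSummand l a = when (sw ℕ.* a ≤? n) (when (a ≤? j) (+ (j C a) ℤ.* (T ℤ.^ a ℤ.* shiftedLayer sw m (n ∸ sw ℕ.* a) l (j ∸ a))))

      summandAt : ℕ → ℕ → ℤ
      summandAt l a = when (sw ℕ.* a ≤? n ∸ l) (when (a ≤? j) (+ (j C a) ℤ.* (T ℤ.^ a ℤ.* layer′ ((n ∸ l) ∸ sw ℕ.* a) (j ∸ a))))

      shiftedSummand-guards : ∀ l a → shiftedSummand l a ≡ when (sw ℕ.* a ≤? n)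
          (when (l ≤? n ∸ sw ℕ.* a) (when (a ≤? j) (+ (j C a) ℤ.* (T ℤ.^ a ℤ.* layer′ ((n ∸ sw ℕ.* a) ∸ l) (j ∸ a)))))
      shiftedSummand-guards l a = cong (when (sw ℕ.* a ≤? n)) (trans (cong (when (a ≤? j))
          (trans (cong (+ (j C a) ℤ.*_) (sym (when-*ˡ (l ≤? n ∸ sw ℕ.* a) (T ℤ.^ a) (layer′ ((n ∸ sw ℕ.* a) ∸ l) (j ∸ a)))))
              (sym (when-*ˡ (l ≤? n ∸ sw ℕ.* a) (+ (j C a)) (T ℤ.^ a ℤ.* layer′ ((n ∸ sw ℕ.* a) ∸ l) (j ∸ a))))))
          (when-comm (a ≤? j) (l ≤? n ∸ sw ℕ.* a) _))

      shiftedSummand-zero : ∀ l a → ¬ (l ≤ n ∸ sw ℕ.* a) → shiftedSummand l a ≡ + 0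
      shiftedSummand-zero l a h = trans (shiftedSummand-guards l a)
          (trans (cong (when (sw ℕ.* a ≤? n)) (when-no (l ≤? n ∸ sw ℕ.* a) h)) (when-0 _))

      sum-shiftedSummand : ∀ l → rangeSum (suc n) (shiftedSummand l) ≡ shiftedLayer w (suc m) n l j
      sum-shiftedSummand l = byCase (l ≤? n)
        where
        byCase : (d : Dec (l ≤ n)) → rangeSum (suc n) (shiftedSummand l) ≡ when d (layer w (suc m) (n ∸ l) j)
        byCase (yes l≤n) = begin
          rangeSum (suc n) (shiftedSummand l)
            ≡⟨ rangeSum-shrink (suc (n ∸ l)) (suc n) (shiftedSummand l) (s≤s (ℕP.m∸n≤m n l)) vanish ⟩
          rangeSum (suc (n ∸ l)) (shiftedSummand l) ≡⟨ rangeSum-cong (suc (n ∸ l)) (λ a _ → shiftedSummand≡summandAt a) ⟩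
          rangeSum (suc (n ∸ l)) (summandAt l) ≡⟨ sym (layer-suc w m (n ∸ l) j) ⟩
          layer w (suc m) (n ∸ l) j ≡⟨ sym (when-yes (yes l≤n) l≤n) ⟩
          when (yes l≤n) (layer w (suc m) (n ∸ l) j) ∎
          where
          open ≡-Reasoning
          vanish : ∀ a → suc (n ∸ l) ≤ a → shiftedSummand l a ≡ + 0
          vanish a h = byGuard (sw ℕ.* a ≤? n)
            where
            byGuard : Dec (sw ℕ.* a ≤ n) → shiftedSummand l a ≡ + 0
            byGuard (yes q) = shiftedSummand-zero l a (λ p → ℕP.<-irrefl refl
                (ℕP.<-≤-trans h (ℕP.≤-trans (ℕP.m≤n*m a (suc w)) (≤∸-swap p q))))
            byGuard (no ¬q) = when-no (sw ℕ.* a ≤? n) ¬q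
          shiftedSummand≡summandAt : ∀ a → shiftedSummand l a ≡ summandAt l a
          shiftedSummand≡summandAt a = trans (shiftedSummand-guards l a) (when-× (sw ℕ.* a ≤? n) (l ≤? n ∸ sw ℕ.* a) (sw ℕ.* a ≤? n ∸ l)
            (λ p1 p3 → ≤∸-swap p3 p1) (λ q → ≤∸⇒≤ {l = l} q) (λ q → ≤∸-swap q l≤n)
            (λ q → cong (λ x → when (a ≤? j) (+ (j C a) ℤ.* (T ℤ.^ a ℤ.* layer′ x (j ∸ a)))) ([n∸s]∸l≡[n∸l]∸s n (sw ℕ.* a) l)))
        byCase (no l≰n) = rangeSum-zero (suc n) (λ a → shiftedSummand-zero l a (λ p → l≰n (ℕP.≤-trans p (ℕP.m∸n≤m n (sw ℕ.* a)))))

      sum-summandˡ : rangeSum (suc n) summandˡ ≡ rangeSum m (λ i → tℕ t (sw ℕ.+ suc i) ℤ.* shiftedLayer w (suc m) n (sw ℕ.+ suc i) j)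
      sum-summandˡ = begin
        rangeSum (suc n) summandˡ ≡⟨ rangeSum-cong (suc n) (λ a _ → summandˡ-expand a) ⟩
        rangeSum (suc n) (λ a → rangeSum m (λ i → coefficient i ℤ.* shiftedSummand (index i) a))
          ≡⟨ ℤSum.∑-comm {suc n} {m} (λ a i → coefficient (toℕ i) ℤ.* shiftedSummand (index (toℕ i)) (toℕ a)) ⟩
        rangeSum m (λ i → rangeSum (suc n) (λ a → coefficient i ℤ.* shiftedSummand (index i) a))
          ≡⟨ rangeSum-cong m (λ i _ → sym (ℤSum.*-distribˡ-sum {suc n} (coefficient i) (λ a → shiftedSummand (index i) (toℕ a)))) ⟩
        rangeSum m (λ i → coefficient i ℤ.* rangeSum (suc n) (shiftedSummand (index i)))
          ≡⟨ rangeSum-cong m (λ i _ → cong₂ ℤ._*_ (cong (tℕ t) (sym (ℕP.+-suc sw i)))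
              (trans (sum-shiftedSummand (index i)) (cong (λ x → shiftedLayer w (suc m) n x j) (sym (ℕP.+-suc sw i))))) ⟩
        rangeSum m (λ i → tℕ t (sw ℕ.+ suc i) ℤ.* shiftedLayer w (suc m) n (sw ℕ.+ suc i) j) ∎
        where
        open ≡-Reasoning
        coefficient : ℕ → ℤ
        coefficient i = tℕ t (suc sw ℕ.+ i)
        index : ℕ → ℕ
        index i = suc sw ℕ.+ i
        summandˡ-expand : ∀ a → summandˡ a ≡ rangeSum m (λ i → coefficient i ℤ.* shiftedSummand (index i) a)
        summandˡ-expand a = begin
          summandˡ a
            ≡⟨ cong (λ x → when (sw ℕ.* a ≤? n) (when (a ≤? j) (+ (j C a) ℤ.* (T ℤ.^ a ℤ.* x)))) (ih (n ∸ sw ℕ.* a) (j ∸ a)) ⟩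
          when g (when d (Cc ℤ.* (T ℤ.^ a ℤ.* rangeSum m (λ i → coefficient i ℤ.* Y i))))
            ≡⟨ cong (λ x → when g (when d (Cc ℤ.* x))) (ℤSum.*-distribˡ-sum {m} (T ℤ.^ a) (λ i → coefficient (toℕ i) ℤ.* Y (toℕ i))) ⟩
          when g (when d (Cc ℤ.* rangeSum m (λ i → T ℤ.^ a ℤ.* (coefficient i ℤ.* Y i))))
            ≡⟨ cong (λ x → when g (when d x)) (ℤSum.*-distribˡ-sum {m} Cc (λ i → T ℤ.^ a ℤ.* (coefficient (toℕ i) ℤ.* Y (toℕ i)))) ⟩
          when g (when d (rangeSum m (λ i → Cc ℤ.* (T ℤ.^ a ℤ.* (coefficient i ℤ.* Y i)))))
            ≡⟨ cong (when g) (when-rangeSum d m (λ i → Cc ℤ.* (T ℤ.^ a ℤ.* (coefficient i ℤ.* Y i)))) ⟩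
          when g (rangeSum m (λ i → when d (Cc ℤ.* (T ℤ.^ a ℤ.* (coefficient i ℤ.* Y i)))))
            ≡⟨ when-rangeSum g m (λ i → when d (Cc ℤ.* (T ℤ.^ a ℤ.* (coefficient i ℤ.* Y i)))) ⟩
          rangeSum m (λ i → when g (when d (Cc ℤ.* (T ℤ.^ a ℤ.* (coefficient i ℤ.* Y i)))))
            ≡⟨ rangeSum-cong m (λ i _ → trans (cong (λ x → when g (when d x)) (c·x·yz≡y·c·xz Cc (T ℤ.^ a) (coefficient i) (Y i)))
                                                                              (trans (cong (when g) (when-*ˡ d (coefficient i)
                                                                                  (Cc ℤ.* (T ℤ.^ a ℤ.* Y i))))
                                                                                  (when-*ˡ g (coefficient i)
                                                                                  (when d (Cc ℤ.* (T ℤ.^ a ℤ.* Y i)))))) ⟩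
          rangeSum m (λ i → coefficient i ℤ.* shiftedSummand (index i) a) ∎
          where
          g : Dec (sw ℕ.* a ≤ n)
          g = sw ℕ.* a ≤? n
          d : Dec (a ≤ j)
          d = a ≤? j
          Cc : ℤ
          Cc = + (j C a)
          Y : ℕ → ℤ
          Y i = shiftedLayer sw m (n ∸ sw ℕ.* a) (index i) (j ∸ a)

      sum-summandʳ : rangeSum n (λ b → summandʳ (suc b)) ≡ tℕ t (sw ℕ.+ 0) ℤ.* shiftedLayer w (suc m) n (sw ℕ.+ 0) j
      sum-summandʳ = trans (byCase (sw ≤? n)) (cong (λ x → tℕ t x ℤ.* shiftedLayer w (suc m) n x j) (sym (ℕP.+-identityʳ sw)))
        where
        byCase : (d : Dec (sw ≤ n)) → rangeSum n (λ b → summandʳ (suc b)) ≡ T ℤ.* when d (layer w (suc m) (n ∸ sw) j)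
        byCase (yes sw≤n) = begin
          rangeSum n (λ b → summandʳ (suc b))
            ≡⟨ sym (rangeSum-shrink n (suc n) (λ b → summandʳ (suc b)) (ℕP.n≤1+n n) summandʳ-vanishes) ⟩
          rangeSum (suc n) (λ b → summandʳ (suc b)) ≡⟨ rangeSum-cong (suc n) (λ b _ → term b) ⟩
          rangeSum (suc n) (λ b → T ℤ.* summandAt sw b)
            ≡⟨ rangeSum-shrink (suc (n ∸ sw)) (suc n) (λ b → T ℤ.* summandAt sw b) (s≤s (ℕP.m∸n≤m n sw)) summandAt-vanishes ⟩
          rangeSum (suc (n ∸ sw)) (λ b → T ℤ.* summandAt sw b)
            ≡⟨ sym (ℤSum.*-distribˡ-sum {suc (n ∸ sw)} T (λ b → summandAt sw (toℕ b))) ⟩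
          T ℤ.* rangeSum (suc (n ∸ sw)) (summandAt sw) ≡⟨ cong (T ℤ.*_) (sym (layer-suc w m (n ∸ sw) j)) ⟩
          T ℤ.* layer w (suc m) (n ∸ sw) j ≡⟨ cong (T ℤ.*_) (sym (when-yes (yes sw≤n) sw≤n)) ⟩
          T ℤ.* when (yes sw≤n) (layer w (suc m) (n ∸ sw) j) ∎
          where
          open ≡-Reasoning
          summandʳ-vanishes : ∀ b → n ≤ b → summandʳ (suc b) ≡ + 0
          summandʳ-vanishes b h = when-no (sw ℕ.* suc b ≤? n)
              (λ p → ℕP.<-irrefl refl (ℕP.≤-trans (s≤s h) (ℕP.≤-trans (ℕP.m≤n*m (suc b) (suc w)) p)))
          summandAt-vanishes : ∀ b → suc (n ∸ sw) ≤ b → T ℤ.* summandAt sw b ≡ + 0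
          summandAt-vanishes b h = trans (cong (T ℤ.*_) (when-no (sw ℕ.* b ≤? n ∸ sw)
              (λ p → ℕP.<-irrefl refl (ℕP.<-≤-trans h (ℕP.≤-trans (ℕP.m≤n*m b (suc w)) p))))) (ℤP.*-zeroʳ T)
          term : ∀ b → summandʳ (suc b) ≡ T ℤ.* summandAt sw b
          term b = begin
            summandʳ (suc b) ≡⟨ when-⇔ (sw ℕ.* suc b ≤? n) (sw ℕ.* b ≤? n ∸ sw)
                    {when (b ≤? j) (+ (j C b) ℤ.* (T ℤ.^ suc b ℤ.* layer′ (n ∸ sw ℕ.* suc b) (j ∸ b)))}
                    {when (b ≤? j) (T ℤ.* (+ (j C b) ℤ.* (T ℤ.^ b ℤ.* layer′ ((n ∸ sw) ∸ sw ℕ.* b) (j ∸ b))))}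
                    (λ p → ℕP.m+n≤o⇒m≤o∸n (sw ℕ.* b) (subst (ℕ._≤ n) (trans (ℕP.*-suc sw b) (ℕP.+-comm sw (sw ℕ.* b))) p))
                    (λ q → subst (ℕ._≤ n) (trans (ℕP.+-comm (sw ℕ.* b) sw) (sym (ℕP.*-suc sw b))) (ℕP.m≤o∸n⇒m+n≤o (sw ℕ.* b) sw≤n q))
                    (λ _ → cong (when (b ≤? j)) inner) ⟩
            when (sw ℕ.* b ≤? n ∸ sw) (when (b ≤? j) (T ℤ.* (+ (j C b) ℤ.* (T ℤ.^ b ℤ.* layer′ ((n ∸ sw) ∸ sw ℕ.* b) (j ∸ b)))))
              ≡⟨ cong (when (sw ℕ.* b ≤? n ∸ sw)) (when-*ˡ (b ≤? j) T _) ⟩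
            when (sw ℕ.* b ≤? n ∸ sw) (T ℤ.* when (b ≤? j) (+ (j C b) ℤ.* (T ℤ.^ b ℤ.* layer′ ((n ∸ sw) ∸ sw ℕ.* b) (j ∸ b))))
              ≡⟨ when-*ˡ (sw ℕ.* b ≤? n ∸ sw) T _ ⟩
            T ℤ.* summandAt sw b ∎
            where
            inner : + (j C b) ℤ.* (T ℤ.^ suc b ℤ.* layer′ (n ∸ sw ℕ.* suc b) (j ∸ b)) ≡ T ℤ.*
                (+ (j C b) ℤ.* (T ℤ.^ b ℤ.* layer′ ((n ∸ sw) ∸ sw ℕ.* b) (j ∸ b)))
            inner = trans (cong (λ x → + (j C b) ℤ.* (T ℤ.^ suc b ℤ.* layer′ x (j ∸ b)))
                (trans (cong (n ∸_) (ℕP.*-suc sw b)) (sym (ℕP.∸-+-assoc n sw (sw ℕ.* b)))))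
                          (c·xy·z≡x·c·yz (+ (j C b)) T (T ℤ.^ b) (layer′ ((n ∸ sw) ∸ sw ℕ.* b) (j ∸ b)))
        byCase (no sw≰n) = trans (rangeSum-zero n (λ b → when-no (sw ℕ.* suc b ≤? n) {when (b ≤? j)
            (+ (j C b) ℤ.* (T ℤ.^ suc b ℤ.* layer′ (n ∸ sw ℕ.* suc b) (j ∸ b)))}
            (λ p → sw≰n (ℕP.≤-trans (subst (sw ≤_) (sym (ℕP.*-suc sw b)) (ℕP.m≤m+n sw (sw ℕ.* b))) p))))
                              (sym (ℤP.*-zeroʳ T))

    layer-recurrence : ∀ m w n j → layer w m n (suc j) ≡ rangeSum m (λ i → tℕ t (suc w ℕ.+ i) ℤ.* shiftedLayer w m n (suc w ℕ.+ i) j)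
    layer-recurrence zero w zero j = refl
    layer-recurrence zero w (suc n) j = refl
    layer-recurrence (suc m) w n j = begin
      layer w (suc m) n (suc j) ≡⟨ layer-suc w m n (suc j) ⟩
      rangeSum (suc n) summand ≡⟨ rangeSum-cong (suc n) (λ a _ → summand-pascal a) ⟩
      rangeSum (suc n) (λ a → summandˡ a ℤ.+ summandʳ a)
        ≡⟨ ℤSum.∑-distrib-+ {suc n} (λ a → summandˡ (toℕ a)) (λ a → summandʳ (toℕ a)) ⟩
      rangeSum (suc n) summandˡ ℤ.+ (+ 0 ℤ.+ rangeSum n (λ b → summandʳ (suc b)))
        ≡⟨ cong₂ ℤ._+_ sum-summandˡ (trans (ℤP.+-identityˡ _) sum-summandʳ) ⟩
      rangeSum m (λ i → tℕ t (suc w ℕ.+ suc i) ℤ.* shiftedLayer w (suc m) n (suc w ℕ.+ suc i) j) ℤ.+ tℕ t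
          (suc w ℕ.+ 0) ℤ.* shiftedLayer w (suc m) n (suc w ℕ.+ 0) j
        ≡⟨ ℤP.+-comm (rangeSum m (λ i → tℕ t (suc w ℕ.+ suc i) ℤ.* shiftedLayer w (suc m) n (suc w ℕ.+ suc i) j))
            (tℕ t (suc w ℕ.+ 0) ℤ.* shiftedLayer w (suc m) n (suc w ℕ.+ 0) j) ⟩
      rangeSum (suc m) (λ i → tℕ t (suc w ℕ.+ i) ℤ.* shiftedLayer w (suc m) n (suc w ℕ.+ i) j) ∎
      where
      open ≡-Reasoning
      open LayerRecurrence w m n j (layer-recurrence m (suc w))

    Fkn≡sum-layers : ∀ n → Fkn k t n ≡ rangeSum (suc n) (layer 0 k n)
    Fkn≡sum-layers n = trans (listSum-sols-cong k 0 n (weighted 0)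
        (λ α → rangeSum (suc n) (λ j → when (vsum α ℕ.≟ j) (weighted 0 α))) single)
                 (listSum-rangeSum (suc n) (λ α j → when (vsum α ℕ.≟ j) (weighted 0 α)) (sols 0 k n))
      where
      single : ∀ α → vsum α ≤ n → weighted 0 α ≡ rangeSum (suc n) (λ j → when (vsum α ℕ.≟ j) (weighted 0 α))
      single α h = sym (trans (ℤSum.sum-single {suc n} (λ i → when (vsum α ℕ.≟ toℕ i) (weighted 0 α)) level
                         (λ i ne → when-no (vsum α ℕ.≟ toℕ i)
                             (λ e → ne (FinP.toℕ-injective (trans (sym e) (sym (FinP.toℕ-fromℕ< (s≤s h))))))))
                         (when-yes (vsum α ℕ.≟ toℕ level) (sym (FinP.toℕ-fromℕ< (s≤s h)))))
        where
        level : Fin (suc n)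
        level = fromℕ< (s≤s h)

    layer-vanishes : ∀ N n j → n < N → n < j → layer 0 k n j ≡ + 0
    layer-vanishes (suc N) n (suc j) n<N n<j = trans (layer-recurrence k 0 n j)
        (rangeSum-zero k (λ i → trans (cong (tℕ t (suc i) ℤ.*_) (byCase i (suc i ≤? n))) (ℤP.*-zeroʳ (tℕ t (suc i)))))
      where
      byCase : ∀ i (d : Dec (suc i ≤ n)) → when d (layer 0 k (n ∸ suc i) j) ≡ + 0
      byCase i (yes p) = layer-vanishes N (n ∸ suc i) j (ℕP.<-≤-trans (ℕP.∸-monoʳ-< {n} {suc i} {0} (s≤s z≤n) p) (ℕ.s≤s⁻¹ n<N))
                         (ℕP.<-≤-trans (ℕP.∸-monoʳ-< {n} {suc i} {0} (s≤s z≤n) p) (ℕ.s≤s⁻¹ n<j))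
      byCase i (no _) = refl

    Fkn-recurrence : ∀ n → Fkn k t (suc n) ≡ rangeSum k (λ i → tℕ t (suc i) ℤ.* when (suc i ≤? suc n) (Fkn k t (n ∸ i)))
    Fkn-recurrence n = begin
      Fkn k t (suc n) ≡⟨ Fkn≡sum-layers (suc n) ⟩
      layer 0 k (suc n) 0 ℤ.+ rangeSum (suc n) (λ j → layer 0 k (suc n) (suc j))
        ≡⟨ cong (λ y → layer 0 k (suc n) 0 ℤ.+ y) (rangeSum-cong (suc n) (λ j _ → layer-recurrence k 0 (suc n) j)) ⟩
      layer 0 k (suc n) 0 ℤ.+ rangeSum (suc n) (λ j → rangeSum k (λ i → tℕ t (suc i) ℤ.* shiftedLayer 0 k (suc n) (suc i) j))
        ≡⟨ cong₂ ℤ._+_ (layer-zero k 0 (suc n)) (ℤSum.∑-comm {suc n} {k}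
            (λ j i → tℕ t (suc (toℕ i)) ℤ.* shiftedLayer 0 k (suc n) (suc (toℕ i)) (toℕ j))) ⟩
      + 0 ℤ.+ rangeSum k (λ i → rangeSum (suc n) (λ j → tℕ t (suc i) ℤ.* shiftedLayer 0 k (suc n) (suc i) j))
        ≡⟨ ℤP.+-identityˡ _ ⟩
      rangeSum k (λ i → rangeSum (suc n) (λ j → tℕ t (suc i) ℤ.* shiftedLayer 0 k (suc n) (suc i) j))
        ≡⟨ rangeSum-cong k (λ i _ → sym (ℤSum.*-distribˡ-sum {suc n} (tℕ t (suc i)) (λ j → shiftedLayer 0 k (suc n) (suc i) (toℕ j)))) ⟩
      rangeSum k (λ i → tℕ t (suc i) ℤ.* rangeSum (suc n) (λ j → shiftedLayer 0 k (suc n) (suc i) j))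
        ≡⟨ rangeSum-cong k (λ i _ → cong (tℕ t (suc i) ℤ.*_) (sum-shiftedLayer i)) ⟩
      rangeSum k (λ i → tℕ t (suc i) ℤ.* when (suc i ≤? suc n) (Fkn k t (n ∸ i))) ∎
      where
      open ≡-Reasoning
      sum-shiftedLayer : ∀ i → rangeSum (suc n) (λ j → shiftedLayer 0 k (suc n) (suc i) j) ≡ when (suc i ≤? suc n) (Fkn k t (n ∸ i))
      sum-shiftedLayer i = begin
        rangeSum (suc n) (λ j → when (suc i ≤? suc n) (layer 0 k (n ∸ i) j))
          ≡⟨ sym (when-rangeSum (suc i ≤? suc n) (suc n) (layer 0 k (n ∸ i))) ⟩
        when (suc i ≤? suc n) (rangeSum (suc n) (layer 0 k (n ∸ i)))
          ≡⟨ cong (when (suc i ≤? suc n)) (rangeSum-shrink (suc (n ∸ i)) (suc n) (layer 0 k (n ∸ i)) (s≤s (ℕP.m∸n≤m n i))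
                                                              (λ j h → layer-vanishes (suc (n ∸ i)) (n ∸ i) j ℕP.≤-refl h)) ⟩
        when (suc i ≤? suc n) (rangeSum (suc (n ∸ i)) (layer 0 k (n ∸ i)))
          ≡⟨ cong (when (suc i ≤? suc n)) (sym (Fkn≡sum-layers (n ∸ i))) ⟩
        when (suc i ≤? suc n) (Fkn k t (n ∸ i)) ∎

    Fkn-zero : Fkn k t 0 ≡ + 1
    Fkn-zero = trans (Fkn≡sum-layers 0) (trans (ℤP.+-identityʳ _) (layer-zero k 0 0))



*-cancel-nonzeroˡ : ∀ (a x : ℚ) → a ≢ 0ℚ → a ℚ.* x ≡ 0ℚ → x ≡ 0ℚ
*-cancel-nonzeroˡ a x a≢0 ax≡0 = begin
  x                     ≡⟨ ℚP.*-identityˡ x ⟨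
  1ℚ ℚ.* x              ≡⟨ P.cong (ℚ._* x) (ℚP.*-inverseˡ a) ⟨
  (a⁻¹ ℚ.* a) ℚ.* x     ≡⟨ ℚP.*-assoc a⁻¹ a x ⟩
  a⁻¹ ℚ.* (a ℚ.* x)     ≡⟨ P.cong (a⁻¹ ℚ.*_) ax≡0 ⟩
  a⁻¹ ℚ.* 0ℚ            ≡⟨ ℚP.*-zeroʳ a⁻¹ ⟩
  0ℚ                    ∎
  where
  open P.≡-Reasoning
  instance
    a-nonZero : ℚ.NonZero a
    a-nonZero = ℚ.≢-nonZero a≢0
  a⁻¹ : ℚ
  a⁻¹ = ℚ.1/ a

+-∸+ : ∀ a b → b ≤ a → + a ℤ.- + b ≡ + (a ∸ b)
+-∸+ a b b≤a = P.trans (ℤP.m-n≡m⊖n a b) (ℤP.⊖-≥ b≤a)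

+-∸+-negative : ∀ a b → a < b → + a ℤ.- + b ≡ -[1+ (b ∸ suc a) ]
+-∸+-negative a b a<b = P.trans (ℤP.m-n≡m⊖n a b) (P.trans (ℤP.⊖-< a<b) (P.cong (λ x → ℤ.- (+ x)) (ℕP.+-∸-assoc 1 a<b)))

module InitialValues {k : ℕ} (t : Fin (suc k) → ℤ) (F : ℤ → ℚ) (fib : IsFibSeq (suc k) t F)
  (tₖ≢0 : t (Fin.fromℕ k) ≢ + 0) where
  open FibonacciPolynomials using (when; when-yes; when-no)
  open FibonacciPolynomials.Layers t using (Fkn-recurrence; Fkn-zero)
  open Windows t F (proj₂ fib) using (window; basis; basis-on; basis-off)
  open ℚSum using (sum; sum-init-last; sum-cong-≋)
  open import Algebra.Properties.Group ℚP.+-0-group using (∙-cancelʳ)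
  open P.≡-Reasoning

  F-nonnegative : ∀ n → F (+ n) ≡ toℚ (Fkn (suc k) t n)
  F-nonnegative = proj₁ fib

  truncated : ℕ → Fin (suc k) → ℚ
  truncated n i = toℚ (when (suc (toℕ i) ≤? suc n) (Fkn (suc k) t (n ∸ toℕ i)))

  Fkn-recurrenceℚ : ∀ n → toℚ (Fkn (suc k) t (suc n)) ≡ sum (λ i → toℚ (t i) ℚ.* truncated n i)
  Fkn-recurrenceℚ n = P.trans (P.cong toℚ (Fkn-recurrence n))
      (P.trans (toℚ-sum {suc k} (λ i → tℕ t (suc (toℕ i)) ℤ.* when (suc (toℕ i) ≤? suc n) (Fkn (suc k) t (n ∸ toℕ i))))
    (sum-cong-≋ {suc k} (λ i → P.trans (toℚ-* (tℕ t (suc (toℕ i))) (when (suc (toℕ i) ≤? suc n) (Fkn (suc k) t (n ∸ toℕ i))))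
        (P.cong (λ x → toℚ x ℚ.* truncated n i) (tℕ-suc t i)))))

  -- Compare the recurrence of F at  k - q  with that of the polynomials: all terms agree except the one with
  -- F(-(q+1)), which is multiplied by tₖ ≠ 0; the measure N bounds q for the induction.
  F-negative : ∀ N q → q < N → q < k → F -[1+ q ] ≡ 0ℚ
  F-negative (suc N) q q<N+1 q<k = *-cancel-nonzeroˡ (tℚ last) (F -[1+ q ]) (tₖ≢0 ∘ toℚ-injective) (∙-cancelʳ
    (sum (λ i → lhs (Fin.inject₁ i))) (tℚ last ℚ.* F -[1+ q ]) 0ℚ (begin
    tℚ last ℚ.* F -[1+ q ] ℚ.+ sum (λ i → lhs (Fin.inject₁ i))
      ≡⟨ ℚP.+-comm (tℚ last ℚ.* F -[1+ q ]) (sum (λ i → lhs (Fin.inject₁ i))) ⟩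
    sum (λ i → lhs (Fin.inject₁ i)) ℚ.+ tℚ last ℚ.* F -[1+ q ] ≡⟨ P.cong (sum (λ i → lhs (Fin.inject₁ i)) ℚ.+_) lhs-last ⟨
    sum (λ i → lhs (Fin.inject₁ i)) ℚ.+ lhs last               ≡⟨ sum-init-last lhs ⟨
    sum lhs                                                    ≡⟨ both-recurrences ⟩
    sum rhs                                                    ≡⟨ sum-init-last rhs ⟩
    sum (λ i → rhs (Fin.inject₁ i)) ℚ.+ rhs last               ≡⟨ P.cong₂ ℚ._+_ (sum-cong-≋ {k} (P.sym ∘ lhs≡rhs)) rhs-last ⟩
    sum (λ i → lhs (Fin.inject₁ i)) ℚ.+ 0ℚ                     ≡⟨ ℚP.+-comm (sum (λ i → lhs (Fin.inject₁ i))) 0ℚ ⟩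
    0ℚ ℚ.+ sum (λ i → lhs (Fin.inject₁ i))                     ∎))
    where
    p n : ℕ
    p = k ∸ q
    n = k ∸ suc q
    p≡n+1 : p ≡ suc n
    p≡n+1 = ℕP.+-∸-assoc 1 q<k
    last : Fin (suc k)
    last = Fin.fromℕ k
    tℚ : Fin (suc k) → ℚ
    tℚ i = toℚ (t i)
    lhs rhs : Fin (suc k) → ℚ
    lhs i = tℚ i ℚ.* F (+ p ℤ.- + suc (toℕ i))
    rhs i = tℚ i ℚ.* truncated n i
    both-recurrences : sum lhs ≡ sum rhs
    both-recurrences = P.trans (P.sym (P.trans (proj₂ fib (+ p)) (∑Fin≡sum lhs)))
      (P.trans (F-nonnegative p) (P.trans (P.cong (λ x → toℚ (Fkn (suc k) t x)) p≡n+1) (Fkn-recurrenceℚ n)))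
    lhs≡rhs : ∀ (i : Fin k) → lhs (Fin.inject₁ i) ≡ rhs (Fin.inject₁ i)
    lhs≡rhs i = P.cong (tℚ (Fin.inject₁ i) ℚ.*_) (byRange (suc (toℕ i) ≤? p))
      where
      toℕi : toℕ (Fin.inject₁ i) ≡ toℕ i
      toℕi = FinP.toℕ-inject₁ i
      byRange : Dec (suc (toℕ i) ≤ p) → F (+ p ℤ.- + suc (toℕ (Fin.inject₁ i))) ≡ truncated n (Fin.inject₁ i)
      byRange (yes i<p) = begin
        F (+ p ℤ.- + suc (toℕ (Fin.inject₁ i)))   ≡⟨ P.cong (λ x → F (+ p ℤ.- + suc x)) toℕi ⟩
        F (+ p ℤ.- + suc (toℕ i))                 ≡⟨ P.cong F (+-∸+ p (suc (toℕ i)) i<p) ⟩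
        F (+ (p ∸ suc (toℕ i)))                   ≡⟨ F-nonnegative _ ⟩
        toℚ (Fkn (suc k) t (p ∸ suc (toℕ i)))     ≡⟨ P.cong (λ x → toℚ (Fkn (suc k) t (x ∸ suc (toℕ i)))) p≡n+1 ⟩
        toℚ (Fkn (suc k) t (n ∸ toℕ i))
          ≡⟨ P.cong toℚ (when-yes (suc (toℕ i) ≤? suc n) (P.subst (suc (toℕ i) ≤_) p≡n+1 i<p)) ⟨
        toℚ (when (suc (toℕ i) ≤? suc n) (Fkn (suc k) t (n ∸ toℕ i)))
                                                  ≡⟨ P.cong (λ x → toℚ (when (suc x ≤? suc n) (Fkn (suc k) t (n ∸ x)))) toℕi ⟨
        truncated n (Fin.inject₁ i)               ∎
      byRange (no i≮p) = begin
        F (+ p ℤ.- + suc (toℕ (Fin.inject₁ i)))   ≡⟨ P.cong (λ x → F (+ p ℤ.- + suc x)) toℕi ⟩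
        F (+ p ℤ.- + suc (toℕ i))                 ≡⟨ P.cong F (+-∸+-negative p (suc (toℕ i)) (ℕP.≰⇒> i≮p)) ⟩
        F -[1+ (suc (toℕ i) ∸ suc p) ]            ≡⟨ F-negative N _ (ℕP.<-≤-trans i-p<q (ℕ.s≤s⁻¹ q<N+1)) (ℕP.<-trans i-p<q q<k) ⟩
        0ℚ                                        ≡⟨ P.cong toℚ (when-no (suc (toℕ (Fin.inject₁ i)) ≤? suc n)
                                                       (λ i<n+1 → i≮p (P.subst (suc (toℕ i) ≤_) (P.sym p≡n+1)
                                                                         (P.subst (λ x → suc x ≤ suc n) toℕi i<n+1)))) ⟨
        truncated n (Fin.inject₁ i)               ∎
        where
        i-p<q : toℕ i ∸ p < q
        i-p<q = ℕP.<-≤-trans (ℕP.∸-monoˡ-< {toℕ i} {p} {k} (FinP.toℕ<n i) (ℕP.≤-pred (ℕP.≰⇒> i≮p)))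
                             (ℕP.≤-reflexive (ℕP.m∸[m∸n]≡n (ℕP.<⇒≤ q<k)))
    lhs-last : lhs last ≡ tℚ last ℚ.* F -[1+ q ]
    lhs-last = P.cong (λ x → tℚ last ℚ.* F x) (P.trans (P.cong (λ x → + p ℤ.- + suc x) (FinP.toℕ-fromℕ k))
                 (P.trans (+-∸+-negative p (suc k) (s≤s (ℕP.m∸n≤m k q))) (P.cong -[1+_] (ℕP.m∸[m∸n]≡n (ℕP.<⇒≤ q<k)))))
    rhs-last : rhs last ≡ 0ℚ
    rhs-last = P.trans (P.cong (tℚ last ℚ.*_) (P.cong toℚ (when-no (suc (toℕ last) ≤? suc n) k+1≰n+1))) (ℚP.*-zeroʳ (tℚ last))
      where
      k+1≰n+1 : ¬ (suc (toℕ last) ≤ suc n)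
      k+1≰n+1 le = ℕP.<-irrefl P.refl (ℕP.≤-<-trans (ℕ.s≤s⁻¹ (P.subst (λ x → suc x ≤ suc n) (FinP.toℕ-fromℕ k) le))
                                                     (P.subst (_≤ k) p≡n+1 (ℕP.m∸n≤m k q)))

  initial-window : ∀ l → window (ℤ.- + k) l ≡ basis k l
  initial-window l = byIndex (toℕ l ℕ.≟ k)
    where
    byIndex : Dec (toℕ l ≡ k) → window (ℤ.- + k) l ≡ basis k l
    byIndex (yes l≡k) = begin
      F (ℤ.- (+ k) ℤ.+ + toℕ l)  ≡⟨ P.cong (λ x → F (ℤ.- (+ k) ℤ.+ + x)) l≡k ⟩
      F (ℤ.- (+ k) ℤ.+ + k)      ≡⟨ P.cong F (ℤP.+-inverseˡ (+ k)) ⟩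
      F (+ 0)                    ≡⟨ F-nonnegative 0 ⟩
      toℚ (Fkn (suc k) t 0)      ≡⟨ P.cong toℚ Fkn-zero ⟩
      1ℚ                         ≡⟨ basis-on l≡k ⟨
      basis k l                  ∎
    byIndex (no l≢k) = begin
      F (ℤ.- (+ k) ℤ.+ + toℕ l)  ≡⟨ P.cong F (P.trans (ℤP.-m+n≡n⊖m k (toℕ l))
                                       (P.trans (ℤP.⊖-< l<k) (P.cong (λ x → ℤ.- (+ x)) (ℕP.+-∸-assoc 1 l<k)))) ⟩
      F -[1+ (k ∸ suc (toℕ l)) ] ≡⟨ F-negative (suc k) _ (s≤s (ℕP.m∸n≤m k (suc (toℕ l))))
                                       (ℕP.∸-monoʳ-< {k} {suc (toℕ l)} {0} (s≤s z≤n) l<k) ⟩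
      0ℚ                         ≡⟨ basis-off l≢k ⟨
      basis k l                  ∎
      where
      l<k : toℕ l < k
      l<k = ℕP.≤∧≢⇒< (ℕ.s≤s⁻¹ (FinP.toℕ<n l)) l≢k

module RationalPolynomials where
  open P using (refl; sym; trans; cong; cong₂; subst; subst₂; module ≡-Reasoning)
  open import Algebra.Properties.CommutativeSemigroup (CommutativeRing.+-commutativeSemigroup ℚP.+-*-commutativeRing) using (interchange)

  Poly : Set
  Poly = ℕ → ℚ

  when : {P : Set} → Dec P → ℚ → ℚ
  when (yes _) x = x
  when (no _) x = 0ℚ

  when-yes : {P : Set} (d : Dec P) {x : ℚ} → P → when d x ≡ x
  when-yes (yes _) p = refl
  when-yes (no ¬p) p = ⊥-elim (¬p p)

  when-no : {P : Set} (d : Dec P) {x : ℚ} → ¬ P → when d x ≡ 0ℚ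
  when-no (yes p) ¬p = ⊥-elim (¬p p)
  when-no (no _) ¬p = refl

  monomial : ℚ → ℕ → Poly
  monomial a j n = when (n ℕ.≟ j) a

  shift : ℕ → Poly → Poly
  shift j p n = when (j ≤? n) (p (n ∸ j))

  ∑upto-cong : ∀ n {f g : ℕ → ℚ} → (∀ i → i ≤ n → f i ≡ g i) → ∑upto n f ≡ ∑upto n g
  ∑upto-cong zero e = e 0 z≤n
  ∑upto-cong (suc n) e = cong₂ ℚ._+_ (∑upto-cong n (λ i h → e i (ℕP.m≤n⇒m≤1+n h))) (e (suc n) ℕP.≤-refl)

  ∑upto-+ : ∀ n (f g : ℕ → ℚ) → ∑upto n (λ i → f i ℚ.+ g i) ≡ ∑upto n f ℚ.+ ∑upto n g
  ∑upto-+ zero f g = refl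
  ∑upto-+ (suc n) f g = trans (cong (ℚ._+ (f (suc n) ℚ.+ g (suc n))) (∑upto-+ n f g))
      (interchange (∑upto n f) (∑upto n g) (f (suc n)) (g (suc n)))

  ∑upto-0 : ∀ n {f : ℕ → ℚ} → (∀ i → i ≤ n → f i ≡ 0ℚ) → ∑upto n f ≡ 0ℚ
  ∑upto-0 zero e = e 0 z≤n
  ∑upto-0 (suc n) e = trans (cong₂ ℚ._+_ (∑upto-0 n (λ i h → e i (ℕP.m≤n⇒m≤1+n h))) (e (suc n) ℕP.≤-refl)) refl

  ∑upto-single : ∀ n (f : ℕ → ℚ) j → j ≤ n → (∀ i → i ≤ n → ¬ (i ≡ j) → f i ≡ 0ℚ) → ∑upto n f ≡ f j
  ∑upto-single zero f zero h e = refl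
  ∑upto-single (suc n) f j h e with j ℕ.≟ suc n
  ... | yes refl = trans (cong (ℚ._+ f (suc n)) (∑upto-0 n (λ i h2 → e i (ℕP.m≤n⇒m≤1+n h2) (λ eq → ℕP.<-irrefl eq (s≤s h2)))))
      (ℚP.+-identityˡ _)
  ... | no ne = trans (cong₂ ℚ._+_ (∑upto-single n f j (ℕP.≤-pred (ℕP.≤∧≢⇒< h ne)) (λ i h2 ne2 → e i (ℕP.m≤n⇒m≤1+n h2) ne2))
                                    (e (suc n) ℕP.≤-refl (λ eq → ne (sym eq)))) (ℚP.+-identityʳ _)

  mulCoeff-+ˡ : ∀ (q q' p : Poly) n → mulCoeff (λ i → q i ℚ.+ q' i) p n ≡ mulCoeff q p n ℚ.+ mulCoeff q' p n
  mulCoeff-+ˡ q q' p n = trans (∑upto-cong n (λ i _ → ℚP.*-distribʳ-+ (p (n ∸ i)) (q i) (q' i))) (∑upto-+ n _ _)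

  mulCoeff-monomial : ∀ a j (p : Poly) n → mulCoeff (monomial a j) p n ≡ a ℚ.* shift j p n
  mulCoeff-monomial a j p n = byDegree (j ≤? n)
    where
    byDegree : Dec (j ≤ n) → mulCoeff (monomial a j) p n ≡ a ℚ.* when (j ≤? n) (p (n ∸ j))
    byDegree (yes h) = trans (∑upto-single n _ j h (λ i _ ne → trans (cong (ℚ._* p (n ∸ i)) (when-no (i ℕ.≟ j) ne))
        (ℚP.*-zeroˡ (p (n ∸ i)))))
                        (trans (cong (ℚ._* p (n ∸ j)) (when-yes (j ℕ.≟ j) refl)) (cong (a ℚ.*_) (sym (when-yes (j ≤? n) h))))
    byDegree (no h) = trans (∑upto-0 n (λ i h2 → trans (cong (ℚ._* p (n ∸ i)) (when-no (i ℕ.≟ j) (λ e → h (subst (_≤ n) e h2))))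
        (ℚP.*-zeroˡ (p (n ∸ i)))))
                       (sym (trans (cong (a ℚ.*_) (when-no (j ≤? n) h)) (ℚP.*-zeroʳ a)))

  degree-or-zero : ∀ d (r : Poly) → (∀ n → d ≤ n → r n ≡ 0ℚ) →
            (∀ n → r n ≡ 0ℚ) ⊎ Σ ℕ (λ d' → d' < d × IsPolyOfDegree d' r)
  degree-or-zero zero r h = inj₁ (λ n → h n z≤n)
  degree-or-zero (suc d) r h with r d ℚP.≟ 0ℚ
  ... | no ne = inj₂ (d , ℕP.≤-refl , ne , (λ n lt → h n lt))
  ... | yes e with degree-or-zero d r (λ n le → vanishes-from-d n le)
    where
    vanishes-from-d : ∀ n → d ≤ n → r n ≡ 0ℚ
    vanishes-from-d n le with n ℕ.≟ d
    ... | yes refl = e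
    ... | no ne = h n (ℕP.≤∧≢⇒< le (λ eq → ne (sym eq)))
  ...   | inj₁ z = inj₁ z
  ...   | inj₂ (d' , lt , deg) = inj₂ (d' , ℕP.m<n⇒m<1+n lt , deg)

  module Division (p : Poly) (d : ℕ) (lead≢0 : p d ≢ 0ℚ) (pdeg : ∀ n → d < n → p n ≡ 0ℚ) (C : Poly) where
    lead⁻¹ : ℚ
    lead⁻¹ = (ℚ.1/ (p d)) {{ℚ.≢-nonZero lead≢0}}

    lead⁻¹*lead : lead⁻¹ ℚ.* p d ≡ 1ℚ
    lead⁻¹*lead = ℚP.*-inverseˡ (p d) {{ℚ.≢-nonZero lead≢0}}

    ratio : ℕ → Poly → ℚ
    ratio e r = r e ℚ.* lead⁻¹

    quotientStep : ℕ → Poly → Poly → Poly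
    quotientStep e q r n = q n ℚ.+ monomial (ratio e r) (e ∸ d) n

    remainderStep : ℕ → Poly → Poly
    remainderStep e r n = r n ℚ.- ratio e r ℚ.* shift (e ∸ d) p n

    -- divide s q r performs the elimination steps at degrees d + s, …, d + 1, d, from the top down.
    divide : ℕ → Poly → Poly → Poly × Poly
    divide zero q r = quotientStep d q r , remainderStep d r
    divide (suc s) q r = divide s (quotientStep (d ℕ.+ suc s) q r) (remainderStep (d ℕ.+ suc s) r)

    Invariant : Poly → Poly → Set
    Invariant q r = ∀ n → mulCoeff q p n ℚ.+ r n ≡ C n

    invariant-step : ∀ e q r → Invariant q r → Invariant (quotientStep e q r) (remainderStep e r)
    invariant-step e q r h n = begin
      mulCoeff (quotientStep e q r) p n ℚ.+ remainderStep e r n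
        ≡⟨ cong (ℚ._+ remainderStep e r n) (trans (mulCoeff-+ˡ q (monomial (ratio e r) (e ∸ d)) p n)
            (cong (mulCoeff q p n ℚ.+_) (mulCoeff-monomial (ratio e r) (e ∸ d) p n))) ⟩
      (mulCoeff q p n ℚ.+ ratio e r ℚ.* shift (e ∸ d) p n) ℚ.+ (r n ℚ.- ratio e r ℚ.* shift (e ∸ d) p n)
        ≡⟨ cancel (mulCoeff q p n) (ratio e r ℚ.* shift (e ∸ d) p n) (r n) ⟩
      mulCoeff q p n ℚ.+ r n ≡⟨ h n ⟩
      C n ∎
      where
      open ≡-Reasoning
      open +-*-Solver
      cancel : ∀ x y z → (x ℚ.+ y) ℚ.+ (z ℚ.- y) ≡ x ℚ.+ z
      cancel = solve 3 (λ x y z → (x :+ y) :+ (z :- y) := x :+ z) refl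

    remainderStep-vanishes : ∀ e r → d ≤ e → (∀ n → e < n → r n ≡ 0ℚ) → ∀ n → e ≤ n → remainderStep e r n ≡ 0ℚ
    remainderStep-vanishes e r de h n en with n ℕ.≟ e
    ... | yes refl = begin
      r e ℚ.- ratio e r ℚ.* shift (e ∸ d) p e ≡⟨ cong (λ x → r e ℚ.- ratio e r ℚ.* x) (when-yes ((e ∸ d) ≤? e) (ℕP.m∸n≤m e d)) ⟩
      r e ℚ.- (r e ℚ.* lead⁻¹) ℚ.* p (e ∸ (e ∸ d)) ≡⟨ cong (λ x → r e ℚ.- (r e ℚ.* lead⁻¹) ℚ.* p x) (ℕP.m∸[m∸n]≡n de) ⟩
      r e ℚ.- (r e ℚ.* lead⁻¹) ℚ.* p d
        ≡⟨ cong (λ x → r e ℚ.- x) (trans (ℚP.*-assoc (r e) lead⁻¹ (p d)) (trans (cong (r e ℚ.*_) lead⁻¹*lead) (ℚP.*-identityʳ (r e)))) ⟩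
      r e ℚ.- r e ≡⟨ ℚP.+-inverseʳ (r e) ⟩
      0ℚ ∎
      where open ≡-Reasoning
    ... | no ne = begin
      r n ℚ.- ratio e r ℚ.* shift (e ∸ d) p n ≡⟨ cong₂ (λ x y → x ℚ.- ratio e r ℚ.* y) (h n lt) sh0 ⟩
      0ℚ ℚ.- ratio e r ℚ.* 0ℚ ≡⟨ cong (λ x → 0ℚ ℚ.- x) (ℚP.*-zeroʳ (ratio e r)) ⟩
      0ℚ ∎
      where
      open ≡-Reasoning
      lt : e < n
      lt = ℕP.≤∧≢⇒< en (λ eq → ne (sym eq))
      sh0 : shift (e ∸ d) p n ≡ 0ℚ
      sh0 with (e ∸ d) ≤? n
      ... | no _ = refl
      ... | yes h2 = pdeg (n ∸ (e ∸ d)) (ℕP.+-cancelˡ-< (e ∸ d) d (n ∸ (e ∸ d))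
                      (subst₂ _<_ (sym (ℕP.m∸n+n≡m de)) (sym (ℕP.m+[n∸m]≡n h2)) lt))

    quotientStep-vanishes : ∀ K e q r → e ∸ d ≤ K → (∀ n → K < n → q n ≡ 0ℚ) → ∀ n → K < n → quotientStep e q r n ≡ 0ℚ
    quotientStep-vanishes K e q r jk h n lt = trans (cong₂ ℚ._+_ (h n lt)
        (when-no (n ℕ.≟ (e ∸ d)) (λ eq → ℕP.<-irrefl (sym eq) (ℕP.≤-<-trans jk lt)))) refl

    divide-correct : ∀ K s q r → s ≤ K → Invariant q r → (∀ n → d ℕ.+ s < n → r n ≡ 0ℚ) → (∀ n → K < n → q n ≡ 0ℚ) →
          Invariant (proj₁ (divide s q r)) (proj₂ (divide s q r)) × (∀ n → d ≤ n → proj₂ (divide s q r) n ≡ 0ℚ) ×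
              (∀ n → K < n → proj₁ (divide s q r) n ≡ 0ℚ)
    divide-correct K zero q r sK h1 h2 h3 =
      invariant-step d q r h1 ,
      remainderStep-vanishes d r ℕP.≤-refl (λ n lt → h2 n (subst (_< n) (sym (ℕP.+-identityʳ d)) lt)) ,
      quotientStep-vanishes K d q r (subst (_≤ K) (sym (ℕP.n∸n≡0 d)) z≤n) h3
    divide-correct K (suc s) q r sK h1 h2 h3 =
      divide-correct K s (quotientStep e q r) (remainderStep e r) (ℕP.<⇒≤ sK) (invariant-step e q r h1)
        (λ n lt → remainderStep-vanishes e r (ℕP.m≤m+n d (suc s)) h2 n (subst (_≤ n) (sym (ℕP.+-suc d s)) lt))
        (quotientStep-vanishes K e q r (subst (_≤ K) (sym (ℕP.m+n∸m≡n d (suc s))) sK) h3)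
      where
      e : ℕ
      e = d ℕ.+ suc s

  quotient-leading : ∀ k d (p q C : Poly) → (∀ n → d < n → p n ≡ 0ℚ) → d ≤ k → (∀ n → k ∸ d < n → q n ≡ 0ℚ) →
                     (∀ n → mulCoeff q p n ≡ C n) → C k ≢ 0ℚ → q (k ∸ d) ≢ 0ℚ
  quotient-leading k d p q C p-vanishes d≤k q-vanishes q*p≡C Cₖ≢0 qₖ₋d≡0 = Cₖ≢0 (begin
    C k                               ≡⟨ q*p≡C k ⟨
    mulCoeff q p k                    ≡⟨ ∑upto-single k (λ i → q i ℚ.* p (k ∸ i)) (k ∸ d) (ℕP.m∸n≤m k d) only-top ⟩
    q (k ∸ d) ℚ.* p (k ∸ (k ∸ d))     ≡⟨ cong (ℚ._* p (k ∸ (k ∸ d))) qₖ₋d≡0 ⟩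
    0ℚ ℚ.* p (k ∸ (k ∸ d))            ≡⟨ ℚP.*-zeroˡ (p (k ∸ (k ∸ d))) ⟩
    0ℚ                                ∎)
    where
    open ≡-Reasoning
    only-top : ∀ i → i ≤ k → ¬ (i ≡ k ∸ d) → q i ℚ.* p (k ∸ i) ≡ 0ℚ
    only-top i i≤k i≢k-d with k ∸ d <? i
    ... | yes k-d<i = trans (cong (ℚ._* p (k ∸ i)) (q-vanishes i k-d<i)) (ℚP.*-zeroˡ (p (k ∸ i)))
    ... | no k-d≮i = trans (cong (q i ℚ.*_) (p-vanishes (k ∸ i) d<k-i)) (ℚP.*-zeroʳ (q i))
      where
      i<k-d : i < k ∸ d
      i<k-d = ℕP.≤∧≢⇒< (ℕP.≮⇒≥ k-d≮i) i≢k-d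
      d<k-i : d < k ∸ i
      d<k-i = ℕP.m+n≤o⇒m≤o∸n (suc d) (subst (_≤ k) (cong suc (ℕP.+-comm i d)) (ℕP.m≤o∸n⇒m+n≤o (suc i) d≤k i<k-d))

module _ (k : ℕ) (t : Fin k → ℤ) where

  charCoeff-top : charCoeff k t k ≡ + 1
  charCoeff-top with k ℕ.≟ k
  ... | yes _   = P.refl
  ... | no k≢k = ⊥-elim (k≢k P.refl)

  charCoeff-below : ∀ {n} → n < k → charCoeff k t n ≡ ℤ.- tℕ t (k ∸ n)
  charCoeff-below {n} n<k with n ℕ.≟ k
  ... | yes n≡k = ⊥-elim (ℕP.<-irrefl n≡k n<k)
  ... | no _ with n <? k
  ...   | yes _   = P.refl
  ...   | no n≮k = ⊥-elim (n≮k n<k)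

  charCoeff-above : ∀ {n} → k < n → charCoeff k t n ≡ + 0
  charCoeff-above {n} k<n with n ℕ.≟ k
  ... | yes n≡k = ⊥-elim (ℕP.<-irrefl (P.sym n≡k) k<n)
  ... | no _ with n <? k
  ...   | yes n<k = ⊥-elim (ℕP.<-asym k<n n<k)
  ...   | no _    = P.refl

module SnocSum (R : CommutativeRing 0ℓ 0ℓ) where
  open CommutativeRing R
  open FinSum R using (sum)
  open import Relation.Binary.Reasoning.Setoid setoid
  open import Algebra.Properties.Ring ring using (-0#≈0#; -‿+-comm)
  open import Algebra.Properties.CommutativeSemigroup +-commutativeSemigroup using (interchange)

  ∑R-cong : ∀ n {f g : ℕ → Carrier} → (∀ i → i < n → f i ≈ g i) → ∑R R n f ≈ ∑R R n g
  ∑R-cong zero    f≈g = refl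
  ∑R-cong (suc n) f≈g = +-cong (∑R-cong n (λ i i<n → f≈g i (ℕP.m<n⇒m<1+n i<n))) (f≈g n ℕP.≤-refl)

  ∑R-cons : ∀ n (f : ℕ → Carrier) → ∑R R (suc n) f ≈ f 0 + ∑R R n (f ∘ suc)
  ∑R-cons zero    f = trans (+-identityˡ _) (sym (+-identityʳ _))
  ∑R-cons (suc n) f = trans (+-congʳ (∑R-cons n f)) (+-assoc _ _ _)

  sum≈∑R : ∀ n (f : ℕ → Carrier) → sum (λ (i : Fin n) → f (toℕ i)) ≈ ∑R R n f
  sum≈∑R zero    f = refl
  sum≈∑R (suc n) f = trans (+-congˡ (sum≈∑R n (f ∘ suc))) (sym (∑R-cons n f))

  ∑R-distrib-+ : ∀ n (f g : ℕ → Carrier) → ∑R R n (λ i → f i + g i) ≈ ∑R R n f + ∑R R n g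
  ∑R-distrib-+ zero    f g = sym (+-identityˡ _)
  ∑R-distrib-+ (suc n) f g = trans (+-congʳ (∑R-distrib-+ n f g)) (interchange _ _ _ _)

  *-distribˡ-∑R : ∀ n (c : Carrier) (f : ℕ → Carrier) → c * ∑R R n f ≈ ∑R R n (λ i → c * f i)
  *-distribˡ-∑R zero    c f = zeroʳ c
  *-distribˡ-∑R (suc n) c f = trans (distribˡ c _ _) (+-congʳ (*-distribˡ-∑R n c f))

  -‿∑R : ∀ n (f : ℕ → Carrier) → - ∑R R n f ≈ ∑R R n (λ i → - f i)
  -‿∑R zero    f = -0#≈0#
  -‿∑R (suc n) f = trans (sym (-‿+-comm _ _)) (+-congʳ (-‿∑R n f))

  ∑R-zero : ∀ n {f : ℕ → Carrier} → (∀ i → i < n → f i ≈ 0#) → ∑R R n f ≈ 0#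
  ∑R-zero zero    f≈0 = refl
  ∑R-zero (suc n) f≈0 = trans (+-cong (∑R-zero n (λ i i<n → f≈0 i (ℕP.m<n⇒m<1+n i<n))) (f≈0 n ℕP.≤-refl)) (+-identityˡ 0#)

  ∑R-extend : ∀ n d (f : ℕ → Carrier) → (∀ i → n ≤ i → f i ≈ 0#) → ∑R R (n ℕ.+ d) f ≈ ∑R R n f
  ∑R-extend n zero    f f≈0 = reflexive (P.cong (λ x → ∑R R x f) (ℕP.+-identityʳ n))
  ∑R-extend n (suc d) f f≈0 = begin
    ∑R R (n ℕ.+ suc d) f           ≈⟨ reflexive (P.cong (λ x → ∑R R x f) (ℕP.+-suc n d)) ⟩
    ∑R R (n ℕ.+ d) f + f (n ℕ.+ d) ≈⟨ +-cong (∑R-extend n d f f≈0) (f≈0 _ (ℕP.m≤m+n n d)) ⟩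
    ∑R R n f + 0#                  ≈⟨ +-identityʳ _ ⟩
    ∑R R n f                       ∎

module AtRoot (R : CommutativeRing 0ℓ 0ℓ) (field-R : IsField R) (charZero : CharZero R)
  {k : ℕ} (t : Fin k → ℤ) (ρ : CommutativeRing.Carrier R) (root : IsRootOfC R k t ρ) where
  open CommutativeRing R
  open import Relation.Binary.Reasoning.Setoid setoid
  open import Algebra.Properties.Ring ring using (-‿distribˡ-*; -0#≈0#)
  open IntegersIn R using (intR-neg)
  open RationalsIn R field-R charZero
  open FinSum R using (sum; sum-cong-≋)
  open SnocSum R
  open MatrixAction R embed embed-isRingHomomorphism
  open CompanionAction R embed embed-isRingHomomorphism t
  open RationalPolynomials

  infixr 8 _^_
  _^_ : Carrier → ℕ → Carrier
  x ^ n = _^R_ R x n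

  ^-+ : ∀ x m n → x ^ (m ℕ.+ n) ≈ x ^ m * x ^ n
  ^-+ x zero    n = sym (*-identityˡ _)
  ^-+ x (suc m) n = trans (*-congˡ (^-+ x m n)) (sym (*-assoc _ _ _))

  powers : Fin k → Carrier
  powers i = ρ ^ toℕ i

  root-equation : ρ ^ k ≈ ∑R R k (λ n → intR R (tℕ t (k ∸ n)) * ρ ^ n)
  root-equation = begin
    ρ ^ k                  ≈⟨ sym (+-identityˡ _) ⟩
    0# + ρ ^ k             ≈⟨ +-congʳ (sym (-‿inverseʳ lower)) ⟩
    (lower - lower) + ρ ^ k ≈⟨ +-assoc _ _ _ ⟩
    lower + (- lower + ρ ^ k) ≈⟨ +-congˡ (+-cong (trans (-‿∑R k _) (∑R-cong k coefficient-below)) coefficient-top) ⟩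
    lower + ∑R R (suc k) (λ n → intR R (charCoeff k t n) * ρ ^ n) ≈⟨ +-congˡ root ⟩
    lower + 0#             ≈⟨ +-identityʳ _ ⟩
    lower                  ∎
    where
    lower : Carrier
    lower = ∑R R k (λ n → intR R (tℕ t (k ∸ n)) * ρ ^ n)
    coefficient-below : ∀ n → n < k → - (intR R (tℕ t (k ∸ n)) * ρ ^ n) ≈ intR R (charCoeff k t n) * ρ ^ n
    coefficient-below n n<k = trans (-‿distribˡ-* _ _)
      (*-congʳ (trans (sym (intR-neg (tℕ t (k ∸ n)))) (reflexive (P.cong (intR R) (P.sym (charCoeff-below k t n<k))))))
    coefficient-top : ρ ^ k ≈ intR R (charCoeff k t k) * ρ ^ k
    coefficient-top = trans (sym (*-identityˡ _))
      (*-congʳ (trans (sym (+-identityʳ 1#)) (reflexive (P.cong (intR R) (P.sym (charCoeff-top k t))))))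

  companion-powers : ∀ i → (companion k t ⊙ powers) i ≈ ρ * powers i
  companion-powers i = byRow (suc (toℕ i) ℕ.≟ k)
    where
    byRow : Dec (suc (toℕ i) ≡ k) → (companion k t ⊙ powers) i ≈ ρ * powers i
    byRow (yes i+1≡k) = begin
      (companion k t ⊙ powers) i                                       ≈⟨ companion-⊙-last powers i+1≡k ⟩
      sum (λ (l : Fin k) → embed (toℚ (tℕ t (k ∸ toℕ l))) * ρ ^ toℕ l)
        ≈⟨ sum-cong-≋ {k} (λ l → *-congʳ (embed-toℚ (tℕ t (k ∸ toℕ l)))) ⟩
      sum (λ (l : Fin k) → intR R (tℕ t (k ∸ toℕ l)) * ρ ^ toℕ l)      ≈⟨ sum≈∑R k (λ n → intR R (tℕ t (k ∸ n)) * ρ ^ n) ⟩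
      ∑R R k (λ n → intR R (tℕ t (k ∸ n)) * ρ ^ n)                     ≈⟨ sym root-equation ⟩
      ρ ^ k                                                            ≈⟨ reflexive (P.cong (ρ ^_) (P.sym i+1≡k)) ⟩
      ρ * powers i                                                     ∎
    byRow (no i+1≢k) = trans (companion-⊙-shift powers i+1<k) (reflexive (P.cong (ρ ^_) (FinP.toℕ-fromℕ< i+1<k)))
      where
      i+1<k : suc (toℕ i) < k
      i+1<k = ℕP.≤∧≢⇒< (FinP.toℕ<n i) i+1≢k

  companion^-powers : ∀ n i → ((companion k t ^M n) ⊙ powers) i ≈ ρ ^ n * powers i
  companion^-powers zero    i = trans (Id-⊙ powers i) (sym (*-identityˡ _))
  companion^-powers (suc n) i = begin
    ((A *M (A ^M n)) ⊙ powers) i      ≈⟨ *M-⊙ A (A ^M n) powers i ⟩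
    (A ⊙ ((A ^M n) ⊙ powers)) i       ≈⟨ ⊙-congʳ A (companion^-powers n) i ⟩
    (A ⊙ (λ l → ρ ^ n * powers l)) i  ≈⟨ ⊙-* A (ρ ^ n) powers i ⟩
    ρ ^ n * (A ⊙ powers) i            ≈⟨ *-congˡ (companion-powers i) ⟩
    ρ ^ n * (ρ * powers i)            ≈⟨ sym (*-assoc _ _ _) ⟩
    (ρ ^ n * ρ) * powers i            ≈⟨ *-congʳ (*-comm _ _) ⟩
    ρ ^ suc n * powers i              ∎
    where
    A : Mat k
    A = companion k t

  evaluateBelow : ℕ → Poly → Carrier
  evaluateBelow N p = ∑R R N (λ i → embed (p i) * ρ ^ i)

  evaluate : Poly → Carrier
  evaluate = evaluateBelow (suc k)

  evaluate-shift : ∀ N j (p : Poly) → evaluateBelow N (shift j p) ≈ ρ ^ j * evaluateBelow (N ∸ j) p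
  evaluate-shift zero    j p = sym (trans (*-congˡ (reflexive (P.cong (λ x → evaluateBelow x p) (ℕP.0∸n≡0 j)))) (zeroʳ _))
  evaluate-shift (suc N) j p = byTerm (j ≤? N)
    where
    byTerm : Dec (j ≤ N) → evaluateBelow (suc N) (shift j p) ≈ ρ ^ j * evaluateBelow (suc N ∸ j) p
    byTerm (yes j≤N) = begin
      evaluateBelow N (shift j p) + embed (shift j p N) * ρ ^ N
        ≈⟨ +-cong (evaluate-shift N j p) (*-cong (reflexive (P.cong embed (when-yes (j ≤? N) j≤N)))
                                                (reflexive (P.cong (ρ ^_) (P.sym (ℕP.m+[n∸m]≡n j≤N))))) ⟩
      ρ ^ j * evaluateBelow (N ∸ j) p + embed (p (N ∸ j)) * ρ ^ (j ℕ.+ (N ∸ j))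
        ≈⟨ +-congˡ (*-congˡ (^-+ ρ j (N ∸ j))) ⟩
      ρ ^ j * evaluateBelow (N ∸ j) p + embed (p (N ∸ j)) * (ρ ^ j * ρ ^ (N ∸ j))
        ≈⟨ +-congˡ (trans (sym (*-assoc _ _ _)) (trans (*-congʳ (*-comm _ _)) (*-assoc _ _ _))) ⟩
      ρ ^ j * evaluateBelow (N ∸ j) p + ρ ^ j * (embed (p (N ∸ j)) * ρ ^ (N ∸ j))
        ≈⟨ sym (distribˡ _ _ _) ⟩
      ρ ^ j * evaluateBelow (suc (N ∸ j)) p
        ≈⟨ *-congˡ (reflexive (P.cong (λ x → evaluateBelow x p) (P.sym (ℕP.+-∸-assoc 1 j≤N)))) ⟩
      ρ ^ j * evaluateBelow (suc N ∸ j) p ∎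
    byTerm (no j≰N) = begin
      evaluateBelow N (shift j p) + embed (shift j p N) * ρ ^ N
        ≈⟨ +-cong (evaluate-shift N j p) (trans (*-congʳ (trans (reflexive (P.cong embed (when-no (j ≤? N) j≰N))) embed-0)) (zeroˡ _)) ⟩
      ρ ^ j * evaluateBelow (N ∸ j) p + 0#
        ≈⟨ +-identityʳ _ ⟩
      ρ ^ j * evaluateBelow (N ∸ j) p
        ≈⟨ *-congˡ (reflexive (P.cong (λ x → evaluateBelow x p)
                   (P.trans (ℕP.m≤n⇒m∸n≡0 (ℕP.<⇒≤ (ℕP.≰⇒> j≰N))) (P.sym (ℕP.m≤n⇒m∸n≡0 (ℕP.≰⇒> j≰N)))))) ⟩
      ρ ^ j * evaluateBelow (suc N ∸ j) p ∎

  evaluate-extend : ∀ (p : Poly) j → j ≤ suc k → (∀ i → suc k ∸ j ≤ i → p i ≡ 0ℚ) → evaluateBelow (suc k ∸ j) p ≈ evaluate p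
  evaluate-extend p j j≤k+1 p-vanishes = sym (trans (reflexive (P.cong (λ x → evaluateBelow x p) (P.sym (ℕP.m∸n+n≡m j≤k+1))))
    (∑R-extend (suc k ∸ j) j _ (λ i le → trans (*-congʳ (trans (reflexive (P.cong embed (p-vanishes i le))) embed-0)) (zeroˡ _))))

  evaluate-sub : ∀ (f g : Poly) c → evaluate (λ i → f i ℚ.- c ℚ.* g i) ≈ evaluate f - embed c * evaluate g
  evaluate-sub f g c = begin
    ∑R R (suc k) (λ i → embed (f i ℚ.- c ℚ.* g i) * ρ ^ i)
      ≈⟨ ∑R-cong (suc k) (λ i _ → trans (*-congʳ (trans (embed-+ (f i) (ℚ.- (c ℚ.* g i)))
                                                         (+-congˡ (trans (embed-neg (c ℚ.* g i)) (-‿cong (embed-* c (g i)))))))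
                                        (trans (distribʳ _ _ _) (+-congˡ (trans (sym (-‿distribˡ-* _ _)) (-‿cong (*-assoc _ _ _)))))) ⟩
    ∑R R (suc k) (λ i → embed (f i) * ρ ^ i + - (embed c * (embed (g i) * ρ ^ i)))
      ≈⟨ ∑R-distrib-+ (suc k) _ _ ⟩
    evaluate f + ∑R R (suc k) (λ i → - (embed c * (embed (g i) * ρ ^ i)))
      ≈⟨ +-congˡ (sym (-‿∑R (suc k) _)) ⟩
    evaluate f - ∑R R (suc k) (λ i → embed c * (embed (g i) * ρ ^ i))
      ≈⟨ +-congˡ (-‿cong (sym (*-distribˡ-∑R (suc k) (embed c) _))) ⟩
    evaluate f - embed c * evaluate g ∎

  charPoly : Poly
  charPoly n = toℚ (charCoeff k t n)

  evaluate-charPoly : evaluate charPoly ≈ 0#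
  evaluate-charPoly = trans (∑R-cong (suc k) (λ i _ → *-congʳ (embed-toℚ (charCoeff k t i)))) root

  evaluate-constant : ∀ (p : Poly) → (∀ n → 0 < n → p n ≡ 0ℚ) → evaluate p ≈ embed (p 0)
  evaluate-constant p p-vanishes = begin
    evaluate p                                                      ≈⟨ ∑R-cons k _ ⟩
    embed (p 0) * ρ ^ 0 + ∑R R k (λ i → embed (p (suc i)) * ρ ^ suc i) ≈⟨ +-cong (*-identityʳ _) (∑R-zero k (λ i _ →
                                                                          trans (*-congʳ (trans (reflexive (P.cong embed
                                                                            (p-vanishes (suc i) (s≤s z≤n)))) embed-0)) (zeroˡ _))) ⟩
    embed (p 0) + 0#                                                ≈⟨ +-identityʳ _ ⟩
    embed (p 0)                                                     ∎

  module DivisionAtRoot (p : Poly) (d : ℕ) (lead≢0 : p d ≢ 0ℚ) (p-vanishes : ∀ n → d < n → p n ≡ 0ℚ)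
    (d≤k : d ≤ k) (p[ρ]≈0 : evaluate p ≈ 0#) where
    open Division p d lead≢0 p-vanishes charPoly

    evaluate-remainderStep : ∀ e r → e ∸ d ≤ k ∸ d → evaluate r ≈ 0# → evaluate (remainderStep e r) ≈ 0#
    evaluate-remainderStep e r j≤k-d r[ρ]≈0 = begin
      evaluate (remainderStep e r)                 ≈⟨ evaluate-sub r (shift j p) (ratio e r) ⟩
      evaluate r - embed (ratio e r) * evaluate (shift j p) ≈⟨ +-cong r[ρ]≈0 (-‿cong (*-congˡ shifted-root)) ⟩
      0# - embed (ratio e r) * 0#                  ≈⟨ +-congˡ (trans (-‿cong (zeroʳ _)) -0#≈0#) ⟩
      0# + 0#                                      ≈⟨ +-identityʳ 0# ⟩
      0#                                           ∎
      where
      j : ℕ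
      j = e ∸ d
      d+j≤k : d ℕ.+ j ≤ k
      d+j≤k = ℕP.≤-trans (ℕP.+-monoʳ-≤ d j≤k-d) (ℕP.≤-reflexive (ℕP.m+[n∸m]≡n d≤k))
      shifted-root : evaluate (shift j p) ≈ 0#
      shifted-root = begin
        evaluateBelow (suc k) (shift j p) ≈⟨ evaluate-shift (suc k) j p ⟩
        ρ ^ j * evaluateBelow (suc k ∸ j) p ≈⟨ *-congˡ (evaluate-extend p j (ℕP.≤-trans (ℕP.m+n≤o⇒n≤o d d+j≤k) (ℕP.n≤1+n k))
                                                 (λ i le → p-vanishes i (ℕP.<-≤-trans (ℕP.m+n≤o⇒m≤o∸n (suc d) (s≤s d+j≤k)) le))) ⟩
        ρ ^ j * evaluate p                  ≈⟨ *-congˡ p[ρ]≈0 ⟩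
        ρ ^ j * 0#                          ≈⟨ zeroʳ _ ⟩
        0#                                  ∎

    evaluate-remainder : ∀ s q r → s ≤ k ∸ d → evaluate r ≈ 0# → evaluate (proj₂ (divide s q r)) ≈ 0#
    evaluate-remainder zero    q r s≤k-d r[ρ]≈0 =
      evaluate-remainderStep d r (P.subst (_≤ k ∸ d) (P.sym (ℕP.n∸n≡0 d)) z≤n) r[ρ]≈0
    evaluate-remainder (suc s) q r s≤k-d r[ρ]≈0 = evaluate-remainder s _ _ (ℕP.<⇒≤ s≤k-d)
      (evaluate-remainderStep (d ℕ.+ suc s) r (P.subst (_≤ k ∸ d) (P.sym (ℕP.m+n∸m≡n d (suc s))) s≤k-d) r[ρ]≈0)

  -- Dividing charPoly by a root p of smaller degree leaves a remainder of still smaller degree which is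
  -- again a root; it cannot be 0 since charPoly is irreducible, so the degree strictly decreases.
  no-root-of-lower-degree : IrreducibleQ charPoly → ∀ N d (p : Poly) → d < N → IsPolyOfDegree d p → d < k →
                            evaluate p ≈ 0# → ⊥
  no-root-of-lower-degree irreducible (suc N) zero p _ (lead≢0 , p-vanishes) _ p[ρ]≈0 =
    lead≢0 (embed≈0⇒≡0 (p 0) (trans (sym (evaluate-constant p p-vanishes)) p[ρ]≈0))
  no-root-of-lower-degree irreducible (suc N) d@(suc _) p (s≤s d≤N) (lead≢0 , p-vanishes) d<k p[ρ]≈0
    = conclude (degree-or-zero d remainder remainder-vanishes)
    where
    open Division p d lead≢0 p-vanishes charPoly
    open DivisionAtRoot p d lead≢0 p-vanishes (ℕP.<⇒≤ d<k) p[ρ]≈0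
    zeroPoly : Poly
    zeroPoly _ = 0ℚ
    quotient remainder : Poly
    quotient  = proj₁ (divide (k ∸ d) zeroPoly charPoly)
    remainder = proj₂ (divide (k ∸ d) zeroPoly charPoly)
    division : Invariant quotient remainder × (∀ n → d ≤ n → remainder n ≡ 0ℚ) × (∀ n → k ∸ d < n → quotient n ≡ 0ℚ)
    division = divide-correct (k ∸ d) (k ∸ d) zeroPoly charPoly ℕP.≤-refl
      (λ n → P.trans (P.cong (ℚ._+ charPoly n) (∑upto-0 n (λ i _ → ℚP.*-zeroˡ (p (n ∸ i))))) (ℚP.+-identityˡ (charPoly n)))
      (λ n k<n → P.cong toℚ (charCoeff-above k t (P.subst (_< n) (ℕP.m+[n∸m]≡n (ℕP.<⇒≤ d<k)) k<n)))
      (λ _ _ → P.refl)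
    remainder-vanishes : ∀ n → d ≤ n → remainder n ≡ 0ℚ
    remainder-vanishes = proj₁ (proj₂ division)
    conclude : (∀ n → remainder n ≡ 0ℚ) ⊎ Σ ℕ (λ d' → d' < d × IsPolyOfDegree d' remainder) → ⊥
    conclude (inj₂ (d' , d'<d , degree-d')) =
      no-root-of-lower-degree irreducible N d' remainder (ℕP.<-≤-trans d'<d d≤N) degree-d' (ℕP.<-trans d'<d d<k)
        (evaluate-remainder (k ∸ d) zeroPoly charPoly ℕP.≤-refl evaluate-charPoly)
    conclude (inj₁ remainder≡0) = proj₂ irreducible
      (k ∸ d , d , quotient , p , (quotient≢0 , quotient-vanishes) , (lead≢0 , p-vanishes) ,
       ℕP.m+n≤o⇒m≤o∸n 1 d<k , s≤s z≤n , quotient*p≡charPoly)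
      where
      quotient-vanishes : ∀ n → k ∸ d < n → quotient n ≡ 0ℚ
      quotient-vanishes = proj₂ (proj₂ division)
      quotient*p≡charPoly : ∀ n → mulCoeff quotient p n ≡ charPoly n
      quotient*p≡charPoly n = P.trans (P.sym (ℚP.+-identityʳ _))
        (P.trans (P.cong (mulCoeff quotient p n ℚ.+_) (P.sym (remainder≡0 n))) (proj₁ division n))
      quotient≢0 : quotient (k ∸ d) ≢ 0ℚ
      quotient≢0 = quotient-leading k d p quotient charPoly p-vanishes (ℕP.<⇒≤ d<k) quotient-vanishes quotient*p≡charPoly
                     (λ e → ℚP.1≢0 (P.trans (P.sym (P.cong toℚ (charCoeff-top k t))) e))

module RootOrder (R : CommutativeRing 0ℓ 0ℓ) (field-R : IsField R) (charZero : CharZero R)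
  {k : ℕ} (t : Fin (suc k) → ℤ) (ρ : CommutativeRing.Carrier R) (root : IsRootOfC R (suc k) t ρ)
  (F : ℤ → ℚ) (recurrence : ∀ n → F n ≡ ∑Fin (λ (i : Fin (suc k)) → toℚ (t i) ℚ.* F (n ℤ.- + suc (toℕ i)))) where
  open CommutativeRing R
  open import Relation.Binary.Reasoning.Setoid setoid
  open import Algebra.Properties.Ring ring using (-‿distribˡ-*)
  open RationalsIn R field-R charZero
  open FinSum R using (sum; sum-cong-≋; ∑-distrib-+; -‿sum)
  open SnocSum R using (sum≈∑R)
  open MatrixAction R embed embed-isRingHomomorphism using (_⊙_; ⊙-cong; Id-⊙)
  open AtRoot R field-R charZero t ρ root
  open Windows t F recurrence using (A; firstRow⇒period)
  open RationalPolynomials using (Poly; degree-or-zero)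
  import Algebra.Properties.Group ℚP.+-0-group as ℚGroup

  order⇒root-power : ∀ c → (A ^M c) ≈M Id → ρ ^ c ≈ 1#
  order⇒root-power c Aᶜ≈Id = begin
    ρ ^ c                        ≈⟨ sym (*-identityʳ _) ⟩
    ρ ^ c * powers Fin.zero      ≈⟨ sym (companion^-powers c Fin.zero) ⟩
    ((A ^M c) ⊙ powers) Fin.zero ≈⟨ ⊙-cong {u = powers} Aᶜ≈Id (λ _ → refl) Fin.zero ⟩
    (Id ⊙ powers) Fin.zero       ≈⟨ Id-⊙ powers Fin.zero ⟩
    1#                           ∎

  -- the first row of  Aᶜ - Id, read as a polynomial of degree < k + 1
  firstRowDefect : ℕ → Poly
  firstRowDefect c n = entry (n <? suc k)
    where
    entry : Dec (n < suc k) → ℚ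
    entry (yes n<k+1) = (A ^M c) Fin.zero (fromℕ< n<k+1) ℚ.- Id Fin.zero (fromℕ< n<k+1)
    entry (no _)      = 0ℚ

  firstRowDefect-entry : ∀ c (l : Fin (suc k)) → firstRowDefect c (toℕ l) ≡ (A ^M c) Fin.zero l ℚ.- Id Fin.zero l
  firstRowDefect-entry c l with toℕ l <? suc k
  ... | yes l<k+1 = P.cong (λ x → (A ^M c) Fin.zero x ℚ.- Id Fin.zero x) (FinP.fromℕ<-toℕ l l<k+1)
  ... | no l≮k+1 = ⊥-elim (l≮k+1 (FinP.toℕ<n l))

  firstRowDefect-vanishes : ∀ c n → suc k ≤ n → firstRowDefect c n ≡ 0ℚ
  firstRowDefect-vanishes c n k+1≤n with n <? suc k
  ... | yes n<k+1 = ⊥-elim (ℕP.<⇒≱ n<k+1 k+1≤n)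
  ... | no _      = P.refl

  -- Row 0 of  Aᶜ ⊙ powers  is ρᶜ, so the defect polynomial vanishes at ρ when ρᶜ = 1.
  evaluate-firstRowDefect : ∀ c → ρ ^ c ≈ 1# → evaluate (firstRowDefect c) ≈ 0#
  evaluate-firstRowDefect c ρᶜ≈1 = begin
    ∑R R (suc k) (λ i → embed (defect i) * ρ ^ i) + embed (defect (suc k)) * ρ ^ suc k
      ≈⟨ +-congˡ (trans (*-congʳ (trans (reflexive (P.cong embed (firstRowDefect-vanishes c (suc k) ℕP.≤-refl))) embed-0)) (zeroˡ _)) ⟩
    ∑R R (suc k) (λ i → embed (defect i) * ρ ^ i) + 0#
      ≈⟨ +-identityʳ _ ⟩
    ∑R R (suc k) (λ i → embed (defect i) * ρ ^ i)
      ≈⟨ sym (sum≈∑R (suc k) (λ i → embed (defect i) * ρ ^ i)) ⟩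
    sum (λ (l : Fin (suc k)) → embed (defect (toℕ l)) * powers l)
      ≈⟨ sum-cong-≋ {suc k} (λ l → trans (*-congʳ (trans (reflexive (P.cong embed (firstRowDefect-entry c l)))
                                (trans (embed-+ (Aᶜ Fin.zero l) (ℚ.- Id Fin.zero l)) (+-congˡ (embed-neg (Id Fin.zero l))))))
                              (trans (distribʳ (powers l) _ _) (+-congˡ (sym (-‿distribˡ-* (embed (Id Fin.zero l)) (powers l)))))) ⟩
    sum (λ l → embed (Aᶜ Fin.zero l) * powers l + - (embed (Id Fin.zero l) * powers l))
      ≈⟨ ∑-distrib-+ (λ l → embed (Aᶜ Fin.zero l) * powers l) (λ l → - (embed (Id Fin.zero l) * powers l)) ⟩
    (Aᶜ ⊙ powers) Fin.zero + sum (λ l → - (embed (Id Fin.zero l) * powers l))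
      ≈⟨ +-congˡ (sym (-‿sum (λ l → embed (Id Fin.zero l) * powers l))) ⟩
    (Aᶜ ⊙ powers) Fin.zero - (Id ⊙ powers) Fin.zero
      ≈⟨ +-cong (trans (companion^-powers c Fin.zero) (trans (*-identityʳ _) ρᶜ≈1)) (-‿cong (Id-⊙ powers Fin.zero)) ⟩
    1# - 1#
      ≈⟨ -‿inverseʳ 1# ⟩
    0# ∎
    where
    Aᶜ : Mat (suc k)
    Aᶜ = A ^M c
    defect : Poly
    defect = firstRowDefect c

  -- By irreducibility the defect polynomial, which has degree ≤ k and vanishes at ρ, is zero.
  root-power⇒period : IrreducibleQ charPoly → ∀ c → ρ ^ c ≈ 1# → ∀ n → F (n ℤ.+ + c) ≡ F n
  root-power⇒period irreducible c ρᶜ≈1 with degree-or-zero (suc k) (firstRowDefect c) (firstRowDefect-vanishes c)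
  ... | inj₂ (d , d<k+1 , degree-d) =
    ⊥-elim (no-root-of-lower-degree irreducible (suc d) d (firstRowDefect c) ℕP.≤-refl degree-d d<k+1 (evaluate-firstRowDefect c ρᶜ≈1))
  ... | inj₁ defect≡0 = firstRow⇒period c (λ l → ℚGroup.x∙y⁻¹≈ε⇒x≈y _ _ (P.trans (P.sym (firstRowDefect-entry c l)) (defect≡0 (toℕ l))))

order⇔period : ∀ {k} (t : Fin (suc k) → ℤ) (F : ℤ → ℚ) → IsFibSeq (suc k) t F → t (Fin.fromℕ k) ≢ + 0 →
               ∀ c → (companion (suc k) t ^M c) ≈M Id ⇔ (∀ n → F (n ℤ.+ + c) ≡ F n)
order⇔period t F fib tₖ≢0 c =
  mk⇔ (λ Aᶜ≈Id → firstRow⇒period c (Aᶜ≈Id Fin.zero)) (period⇒order c (InitialValues.initial-window t F fib tₖ≢0))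
  where open Windows t F (proj₂ fib)

root-power⇔period : ∀ (R : CommutativeRing 0ℓ 0ℓ) → IsField R → CharZero R →
                    ∀ {k} (t : Fin (suc k) → ℤ) (F : ℤ → ℚ) → IsFibSeq (suc k) t F → t (Fin.fromℕ k) ≢ + 0 →
                    IrreducibleQ (λ n → toℚ (charCoeff (suc k) t n)) → ∀ ρ → IsRootOfC R (suc k) t ρ →
                    ∀ c → CommutativeRing._≈_ R (_^R_ R ρ c) (CommutativeRing.1# R) ⇔ (∀ n → F (n ℤ.+ + c) ≡ F n)
root-power⇔period R field-R charZero t F fib tₖ≢0 irreducible ρ root c =
  mk⇔ (root-power⇒period irreducible c) (order⇒root-power c ∘ Equivalence.from (order⇔period t F fib tₖ≢0 c))
  where open RootOrder R field-R charZero t ρ root F (proj₂ fib)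

IsLeastPositive : (ℕ → Set) → ℕ → Set
IsLeastPositive P m = (1 ≤ m × P m) × (∀ m' → 1 ≤ m' → P m' → m ≤ m')

module _ {P Q : ℕ → Set} (P⇔Q : ∀ c → P c ⇔ Q c) where
  open Equivalence

  ∃-positive-⇔ : (∃ λ c → 1 ≤ c × P c) ⇔ (∃ λ c → 1 ≤ c × Q c)
  ∃-positive-⇔ = mk⇔ (λ (c , 1≤c , Pc) → c , 1≤c , to (P⇔Q c) Pc) (λ (c , 1≤c , Qc) → c , 1≤c , from (P⇔Q c) Qc)

  isLeastPositive-⇔ : ∀ m → IsLeastPositive P m ⇔ IsLeastPositive Q m
  isLeastPositive-⇔ m = mk⇔
    (λ ((1≤m , Pm) , least) → (1≤m , to (P⇔Q m) Pm) , (λ m' 1≤m' Qm' → least m' 1≤m' (from (P⇔Q m') Qm')))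
    (λ ((1≤m , Qm) , least) → (1≤m , from (P⇔Q m) Qm) , (λ m' 1≤m' Pm' → least m' 1≤m' (to (P⇔Q m') Pm')))

isLeastPositive⇔isLeastPeriod : ∀ F m → IsLeastPositive (λ c → ∀ n → F (n ℤ.+ + c) ≡ F n) m ⇔ IsLeastPeriod F m
isLeastPositive⇔isLeastPeriod F m = mk⇔ (λ (period , least) → period , (λ c (1≤c , periodic) → least c 1≤c periodic))
                                        (λ (period , least) → period , (λ c 1≤c periodic → least c (1≤c , periodic)))


corollary3p2 : (k : ℕ) (k≥1 : 1 ≤ k) (t : Fin k → ℤ) → t (lastIdx k≥1) ≢ + 0 →
    (F : ℤ → ℚ) → IsFibSeq k t F →
    ((HasFiniteOrderM (companion k t) ⇔ Periodic F) ×
     (∀ (m : ℕ) → HasFiniteOrderM (companion k t) →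
        (IsOrderM (companion k t) m ⇔ IsLeastPeriod F m))) ×
    (IrreducibleQ (λ n → toℚ (charCoeff k t n)) → Periodic F →
     (R : CommutativeRing 0ℓ 0ℓ) → IsField R → CharZero R → AlgClosed R →
     (λ' : CommutativeRing.Carrier R) → IsRootOfC R k t λ' →
       HasFiniteOrderR R λ' ×
       (∀ (m : ℕ) → IsOrderR R λ' m ⇔ IsLeastPeriod F m))
corollary3p2 (suc k) (s≤s z≤n) t tₖ≢0 F fib =
  (∃-positive-⇔ orders⇔periods , λ m _ → isLeastPositive⇔isLeastPeriod F m ⇔-∘ isLeastPositive-⇔ orders⇔periods m) ,
  λ irreducible periodic R field-R charZero _ ρ root →
    let root-powers⇔periods = root-power⇔period R field-R charZero t F fib tₖ≢0 irreducible ρ root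
    in Equivalence.from (∃-positive-⇔ root-powers⇔periods) periodic ,
       λ m → isLeastPositive⇔isLeastPeriod F m ⇔-∘ isLeastPositive-⇔ root-powers⇔periods m
  where
  orders⇔periods : ∀ c → (companion (suc k) t ^M c) ≈M Id ⇔ (∀ n → F (n ℤ.+ + c) ≡ F n)
  orders⇔periods = order⇔period t F fib tₖ≢0
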